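{- Let $A\subset\mathbb R^d$ be a point configuration labelled by $[n]$ and let $[X_1,Y_1]$, $[X_2,Y_2]$ be tiles. Then $[X_1,Y_1]$ and $[X_2,Y_2]$ are separated if and only if there is an affine functional $f:\mathbb R^d\to\mathbb R$ with $f(a_i)>0$ for $i\in(X_1\setminus X_2)\cup(Y_1\setminus Y_2)$, $f(a_i)<0$ for $i\in(X_2\setminus X_1)\cup(Y_2\setminus Y_1)$, and $f(a_i)=0$ for $i\in(Y_1\cap Y_2)\setminus(X_1\cup X_2)$.
   Context: $A=\{a_1,\dots,a_n\}$. A tile is an interval $[X,Y]=\{I:X\subseteq I\subseteq Y\}$ of $2^{[n]}$ with $X\subseteq Y\subseteq[n]$. An (oriented) circuit of $A$ is a pair $(C^+,C^-)$ of disjoint subsets of $[n]$ such that $C=C^+\cup C^-$ is a minimal affinely dependent set and there is an affine dependence $\sum_{i\in C}\lambda_ia_i=0$, $\sum_{i\in C}\lambda_i=0$, with $C^+=\{i:\lambda_i>0\}$, $C^-=\{i:\lambda_i<0\}$. Two tiles $[X_1,Y_1]$, $[X_2,Y_2]$ are separated if there is no circuit $(C^+,C^-)$ of $A$ with $C^+\subseteq Y_1\setminus X_2$, $C^-\subseteq Y_2\setminus X_1$ and $C^+\cup C^-\not\subseteq(Y_1\cap Y_2)\setminus(X_1\cup X_2)$. -}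

module Defs where

open import Level using (Level; _⊔_)
open import Algebra.Bundles using (CommutativeRing)
open import Relation.Binary.Structures using (IsStrictTotalOrder)
open import Relation.Nullary using (¬_)
open import Data.Nat using (ℕ) renaming (zero to nz; suc to ns)
open import Data.Fin using (Fin; zero; suc)
open import Data.Fin.Subset using (Subset; _∈_; _∉_; _⊆_; _⊂_; _∩_; _∪_; _─_)
open import Data.Product using (Σ; ∃; _×_; _,_)
open import Data.Empty using (⊥)

record OrderedField (c ℓ₁ ℓ₂ : Level) : Set (Level.suc (c ⊔ ℓ₁ ⊔ ℓ₂)) where
  field
    commutativeRing : CommutativeRing c ℓ₁
  open CommutativeRing commutativeRing public
  field
    _<_                : Carrier → Carrier → Set ℓ₂
    isStrictTotalOrder : IsStrictTotalOrder _≈_ _<_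
    0<1                : 0# < 1#
    +-monoˡ-<          : ∀ {x y} z → x < y → (x + z) < (y + z)
    *-pos              : ∀ {x y} → 0# < x → 0# < y → 0# < (x * y)
    inverse            : ∀ x → ¬ (x ≈ 0#) → ∃ λ y → (x * y) ≈ 1#

module _ {c ℓ₁ ℓ₂ : Level} (F : OrderedField c ℓ₁ ℓ₂) where
  open OrderedField F using (Carrier; _≈_; _+_; _*_; 0#; 1#; _<_)

  sumF : ∀ {k : ℕ} → (Fin k → Carrier) → Carrier
  sumF {nz}  v = 0#
  sumF {ns k} v = v zero + sumF (λ i → v (suc i))

  Config : ℕ → ℕ → Set c
  Config d n = Fin n → Fin d → Carrier

  IsAffineDependence : ∀ {d n} → Config d n → (Fin n → Carrier) → Set ℓ₁
  IsAffineDependence {d} A μ =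
    (∀ (j : Fin d) → sumF (λ i → μ i * A i j) ≈ 0#) × (sumF μ ≈ 0#)

  AffinelyDependent : ∀ {d n} → Config d n → Subset n → Set (c ⊔ ℓ₁)
  AffinelyDependent {d} {n} A S =
    Σ (Fin n → Carrier) λ μ →
      IsAffineDependence A μ
      × (∀ i → i ∉ S → μ i ≈ 0#)
      × ∃ (λ i → ¬ (μ i ≈ 0#))

  MinimalDependent : ∀ {d n} → Config d n → Subset n → Set (c ⊔ ℓ₁)
  MinimalDependent A S =
    AffinelyDependent A S × (∀ T → T ⊂ S → ¬ AffinelyDependent A T)

  IsCircuit : ∀ {d n} → Config d n → Subset n → Subset n → Set (c ⊔ ℓ₁ ⊔ ℓ₂)
  IsCircuit {d} {n} A C⁺ C⁻ =
    (∀ i → i ∈ C⁺ → i ∈ C⁻ → ⊥)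
    × MinimalDependent A (C⁺ ∪ C⁻)
    × Σ (Fin n → Carrier) λ λ' →
        IsAffineDependence A λ'
        × (∀ i → i ∉ (C⁺ ∪ C⁻) → λ' i ≈ 0#)
        × (∀ i → i ∈ C⁺ → 0# < λ' i)
        × (∀ i → i ∈ C⁻ → λ' i < 0#)

  IsTile : ∀ {n} → Subset n → Subset n → Set
  IsTile X Y = X ⊆ Y

  Separated : ∀ {d n} → Config d n →
              Subset n → Subset n → Subset n → Subset n → Set (c ⊔ ℓ₁ ⊔ ℓ₂)
  Separated {d} {n} A X₁ Y₁ X₂ Y₂ =
    ¬ (Σ (Subset n) λ C⁺ → Σ (Subset n) λ C⁻ →
         IsCircuit A C⁺ C⁻
         × C⁺ ⊆ (Y₁ ─ X₂)
         × C⁻ ⊆ (Y₂ ─ X₁)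
         × ¬ ((C⁺ ∪ C⁻) ⊆ ((Y₁ ∩ Y₂) ─ (X₁ ∪ X₂))))

  AffineFunctional : ℕ → Set c
  AffineFunctional d = (Fin d → Carrier) × Carrier

  evalAff : ∀ {d} → AffineFunctional d → (Fin d → Carrier) → Carrier
  evalAff (w , b) x = sumF (λ j → w j * x j) + b

-- (⇐) For a circuit λ with C⁺ ⊆ Y₁∖X₂ and C⁻ ⊆ Y₂∖X₁ we have C⁺ ⊆ Pos∪Zer
-- and C⁻ ⊆ Neg∪Zer, so every term of Σ λᵢ f(aᵢ) = 0 is ≥ 0, and one is > 0
-- unless the circuit lies in Zer.
-- (⇒) Finding f is a linear feasibility problem.  By Farkas' lemma (proved
-- by Fourier–Motzkin elimination) it is solvable, or there is an affine
-- dependence conformal to the sign pattern: ≥ 0 on Pos, ≤ 0 on Neg, 0 off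
-- Pos∪Neg∪Zer and nonzero on Pos∪Neg.  By the ratio test and induction on
-- the support, a conformal dependence of minimal support is a circuit, and
-- such a circuit contradicts separation.
module Submission where

open import Level using (Level; _⊔_; 0ℓ)
open import Algebra.Bundles using (CommutativeRing; RawRing)
open import Algebra.Solver.Ring.AlmostCommutativeRing
  using (fromCommutativeRing; _-Raw-AlmostCommutative⟶_)
open import Data.Bool using (true)
open import Data.Empty using (⊥; ⊥-elim)
open import Data.Fin using (Fin; zero; suc; _↑ˡ_; _↑ʳ_)
open import Data.Fin.Properties using (any?)
open import Data.Fin.Subset using (Subset; inside; outside; _∈_; _∉_; _⊆_; _⊂_; _∩_; _∪_; _─_; ∣_∣)
open import Data.Fin.Subset.Properties
  using (_∈?_; x∈p∪q⁺; x∈p∪q⁻; x∈p∩q⁺; x∈p∩q⁻; x∈p∧x∉q⇒x∈p─q; p─q⊆p; p⊂q⇒∣p∣<∣q∣)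
open import Data.List using (List; filter; allFin)
open import Data.List.Membership.Propositional.Properties using (∈-filter⁺; ∈-allFin)
import Data.List.Relation.Unary.All as All
open import Data.List.Relation.Unary.All.Properties using (all-filter)
open import Data.Maybe using (Maybe; just; nothing)
open import Data.Nat as ℕ using (ℕ)
open import Data.Nat.Induction using (<-wellFounded)
open import Data.Product using (Σ; ∃; _×_; _,_; proj₁; proj₂)
open import Data.Sum using (_⊎_; inj₁; inj₂; [_,_]′; map₂) renaming (map to map-⊎)
open import Data.Vec using (tabulate; _∷_; here; there)
open import Data.Vec.Functional using (Vector; _++_)
open import Data.Vec.Functional.Properties using (lookup-++ˡ; lookup-++ʳ)
open import Data.Vec.Properties using (lookup∘tabulate; []=⇒lookup; lookup⇒[]=)
open import Function using (_∘_)
open import Function.Bundles using (_⇔_; mk⇔)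
open import Induction.WellFounded using (Acc; acc)
open import Relation.Binary.Bundles using (StrictTotalOrder; DecTotalOrder)
open import Relation.Binary.Definitions using (tri<; tri≈; tri>)
open import Relation.Binary.PropositionalEquality as ≡ using (_≡_)
open import Relation.Binary.Structures using (IsStrictTotalOrder)
open import Relation.Nullary using (¬_; Dec; yes; no; does; ¬?)
open import Relation.Nullary.Decidable using (_×-dec_; dec-true; decidable-stable)
open import Relation.Unary using (Pred; Decidable)

open import Defs

-- The library solver
-- needs coefficients whose equality is decided by computation; we take
-- formal differences (a , b) of natural numbers, denoting a·1 − b·1 in R.
module IntegerCoefficients {c ℓ : Level} (R : CommutativeRing c ℓ) where
  open CommutativeRing R
  open import Algebra.Properties.Ring ring
    using (-0#≈0#; -‿+-comm; ⁻¹-anti-homo‿-; x[y-z]≈xy-xz; [y-z]x≈yx-zx)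
  open import Algebra.Properties.Semiring.Mult semiring
    using (×-homo-+; ×1-homo-*) renaming (_×_ to _×ₙ_)
  open import Algebra.Solver.CommutativeMonoid +-commutativeMonoid
    using (_⊕_; _⊜_) renaming (solve to +-solve)
  open import Relation.Binary.Reasoning.Setoid setoid

  sub-interchange : ∀ x y z w → (x + z) - (y + w) ≈ (x - y) + (z - w)
  sub-interchange x y z w = begin
    (x + z) + - (y + w)    ≈⟨ +-congˡ (-‿+-comm y w) ⟨
    (x + z) + (- y + - w)  ≈⟨ +-solve 4 (λ a b c d → (a ⊕ b) ⊕ (c ⊕ d) ⊜ (a ⊕ c) ⊕ (b ⊕ d))
                                      refl x z (- y) (- w) ⟩
    (x + - y) + (z + - w)  ∎

  diff-product : ∀ x y z w → (x - y) * (z - w) ≈ (x * z + y * w) - (x * w + y * z)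
  diff-product x y z w = begin
    (x - y) * (z - w)                  ≈⟨ [y-z]x≈yx-zx (z - w) x y ⟩
    x * (z - w) - y * (z - w)          ≈⟨ +-cong (x[y-z]≈xy-xz x z w) (-‿cong (x[y-z]≈xy-xz y z w)) ⟩
    (x * z - x * w) - (y * z - y * w)  ≈⟨ +-congˡ (⁻¹-anti-homo‿- (y * z) (y * w)) ⟩
    (x * z - x * w) + (y * w - y * z)  ≈⟨ sub-interchange (x * z) (x * w) (y * w) (y * z) ⟨
    (x * z + y * w) - (x * w + y * z)  ∎

  cross-sum : ∀ {x y z w} → x + w ≈ y + z → x - y ≈ z - w
  cross-sum {x} {y} {z} {w} eq = begin
    x - y              ≈⟨ +-identityʳ (x - y) ⟨
    (x - y) + 0#       ≈⟨ +-congˡ (-‿inverseʳ w) ⟨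
    (x - y) + (w - w)  ≈⟨ sub-interchange x y w w ⟨
    (x + w) - (y + w)  ≈⟨ +-cong eq (-‿cong (+-comm y w)) ⟩
    (y + z) - (w + y)  ≈⟨ sub-interchange y w z y ⟩
    (y - w) + (z - y)  ≈⟨ +-solve 4 (λ a b c d → (a ⊕ b) ⊕ (c ⊕ d) ⊜ (c ⊕ b) ⊕ (a ⊕ d))
                                  refl y (- w) z (- y) ⟩
    (z - w) + (y - y)  ≈⟨ +-congˡ (-‿inverseʳ y) ⟩
    (z - w) + 0#       ≈⟨ +-identityʳ (z - w) ⟩
    z - w              ∎

  Differences : RawRing 0ℓ 0ℓ
  Differences = record
    { Carrier = ℕ × ℕ
    ; _≈_     = _≡_
    ; _+_     = λ (a , b) (c , d) → (a ℕ.+ c , b ℕ.+ d)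
    ; _*_     = λ (a , b) (c , d) → (a ℕ.* c ℕ.+ b ℕ.* d , a ℕ.* d ℕ.+ b ℕ.* c)
    ; -_      = λ (a , b) → (b , a)
    ; 0#      = (0 , 0)
    ; 1#      = (1 , 0)
    }

  ⟦_⟧ : ℕ × ℕ → Carrier
  ⟦ a , b ⟧ = a ×ₙ 1# - b ×ₙ 1#

  embedding : Differences -Raw-AlmostCommutative⟶ fromCommutativeRing R
  embedding = record
    { ⟦_⟧    = ⟦_⟧
    ; +-homo = λ (a , b) (c , d) →
        trans (+-cong (×-homo-+ 1# a c) (-‿cong (×-homo-+ 1# b d))) (sub-interchange _ _ _ _)
    ; *-homo = λ (a , b) (c , d) → trans
        (+-cong (trans (×-homo-+ 1# (a ℕ.* c) (b ℕ.* d)) (+-cong (×1-homo-* a c) (×1-homo-* b d)))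
                (-‿cong (trans (×-homo-+ 1# (a ℕ.* d) (b ℕ.* c)) (+-cong (×1-homo-* a d) (×1-homo-* b c)))))
        (sym (diff-product _ _ _ _))
    ; -‿homo = λ (a , b) → sym (⁻¹-anti-homo‿- (a ×ₙ 1#) (b ×ₙ 1#))
    ; 0-homo = -‿inverseʳ 0#
    ; 1-homo = trans (+-congʳ (+-identityʳ 1#)) (trans (+-congˡ -0#≈0#) (+-identityʳ 1#))
    }

  _coeff≟_ : ∀ x y → Maybe (⟦ x ⟧ ≈ ⟦ y ⟧)
  (a , b) coeff≟ (c , d) with a ℕ.+ d ℕ.≟ b ℕ.+ c
  ... | yes eq = just (cross-sum (trans (sym (×-homo-+ 1# a d))
                                 (trans (reflexive (≡.cong (_×ₙ 1#) eq)) (×-homo-+ 1# b c))))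
  ... | no _   = nothing

  open import Algebra.Solver.Ring Differences (fromCommutativeRing R) embedding _coeff≟_ public
    using (solve; _:=_; _:+_; _:*_; :-_; _:-_)

module OrderedFieldProperties {c ℓ₁ ℓ₂ : Level} (F : OrderedField c ℓ₁ ℓ₂) where
  open OrderedField F hiding (_<_; zero)

  infix 4 _<_
  _<_ : Carrier → Carrier → Set ℓ₂
  _<_ = OrderedField._<_ F

  open IsStrictTotalOrder isStrictTotalOrder public
    using (compare; _≟_; _<?_; <-respʳ-≈; <-respˡ-≈)
    renaming (trans to <-trans; irrefl to <-irrefl; asym to <-asym)
  open IntegerCoefficients commutativeRing public
    using (solve; _:=_; _:+_; _:*_; :-_; _:-_)
  open import Algebra.Properties.Ring ring public
    using (-0#≈0#; -‿involutive; -‿distribˡ-*; -‿distribʳ-*; -1*x≈-x)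
  -- The non-strict order  x ≤ y  is  x < y ⊎ x ≈ y.
  open import Relation.Binary.Construct.StrictToNonStrict _≈_ _<_ as NonStrict public
    using (_≤_; <⇒≤)
  open import Relation.Binary.Reasoning.Setoid setoid

  strictTotalOrder : StrictTotalOrder c ℓ₁ ℓ₂
  strictTotalOrder = record { isStrictTotalOrder = isStrictTotalOrder }

  open import Relation.Binary.Properties.StrictTotalOrder strictTotalOrder public
    using (decTotalOrder)
  open DecTotalOrder decTotalOrder public
    using (totalOrder; ≤-respʳ-≈; ≤-respˡ-≈)
    renaming (refl to ≤-refl; reflexive to ≤-reflexive; trans to ≤-trans; antisym to ≤-antisym)

  <-≤-trans : ∀ {x y z} → x < y → y ≤ z → x < z
  <-≤-trans = NonStrict.<-≤-trans <-trans <-respʳ-≈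

  ≤-<-trans : ∀ {x y z} → x ≤ y → y < z → x < z
  ≤-<-trans = NonStrict.≤-<-trans sym <-trans <-respˡ-≈

  <⇒≉ : ∀ {x y} → x < y → ¬ (x ≈ y)
  <⇒≉ x<y x≈y = <-irrefl x≈y x<y

  ≤⇒≯ : ∀ {x y} → x ≤ y → ¬ (y < x)
  ≤⇒≯ x≤y y<x = <-irrefl refl (≤-<-trans x≤y y<x)

  ≮⇒≥ : ∀ {x y} → ¬ (x < y) → y ≤ x
  ≮⇒≥ {x} {y} x≮y with compare x y
  ... | tri< x<y _ _ = ⊥-elim (x≮y x<y)
  ... | tri≈ _ x≈y _ = ≤-reflexive (sym x≈y)
  ... | tri> _ _ y<x = <⇒≤ y<x

  ≉⇒<⊎> : ∀ {x y} → ¬ (x ≈ y) → x < y ⊎ y < x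
  ≉⇒<⊎> {x} {y} x≉y with compare x y
  ... | tri< x<y _ _ = inj₁ x<y
  ... | tri≈ _ x≈y _ = ⊥-elim (x≉y x≈y)
  ... | tri> _ _ y<x = inj₂ y<x

  +-monoˡ-≤ : ∀ {x y} z → x ≤ y → x + z ≤ y + z
  +-monoˡ-≤ z (inj₁ x<y) = <⇒≤ (+-monoˡ-< z x<y)
  +-monoˡ-≤ z (inj₂ x≈y) = ≤-reflexive (+-congʳ x≈y)

  +-monoʳ-≤ : ∀ {x y} z → x ≤ y → z + x ≤ z + y
  +-monoʳ-≤ {x} {y} z x≤y = ≤-respˡ-≈ (+-comm x z) (≤-respʳ-≈ (+-comm y z) (+-monoˡ-≤ z x≤y))

  0≤+ : ∀ {x y} → 0# ≤ x → 0# ≤ y → 0# ≤ x + y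
  0≤+ {x} {y} 0≤x 0≤y = ≤-respˡ-≈ (+-identityʳ 0#) (≤-trans (+-monoˡ-≤ 0# 0≤x) (+-monoʳ-≤ x 0≤y))

  0<+ : ∀ {x y} → 0# < x → 0# ≤ y → 0# < x + y
  0<+ {x} {y} 0<x 0≤y = <-respˡ-≈ (+-identityʳ 0#) (<-≤-trans (+-monoˡ-< 0# 0<x) (+-monoʳ-≤ x 0≤y))

  y-x+x≈y : ∀ x y → (y - x) + x ≈ y
  y-x+x≈y x y = solve 2 (λ x y → (y :- x) :+ x := y) refl x y

  0<y-x⇒x<y : ∀ {x y} → 0# < y - x → x < y
  0<y-x⇒x<y {x} {y} p = <-respˡ-≈ (+-identityˡ x) (<-respʳ-≈ (y-x+x≈y x y) (+-monoˡ-< x p))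

  0≤y-x⇒x≤y : ∀ {x y} → 0# ≤ y - x → x ≤ y
  0≤y-x⇒x≤y {x} {y} p = ≤-respˡ-≈ (+-identityˡ x) (≤-respʳ-≈ (y-x+x≈y x y) (+-monoˡ-≤ x p))

  x<y⇒0<y-x : ∀ {x y} → x < y → 0# < y - x
  x<y⇒0<y-x {x} {y} p = <-respˡ-≈ (-‿inverseʳ x) (+-monoˡ-< (- x) p)

  x≤y⇒0≤y-x : ∀ {x y} → x ≤ y → 0# ≤ y - x
  x≤y⇒0≤y-x {x} {y} p = ≤-respˡ-≈ (-‿inverseʳ x) (+-monoˡ-≤ (- x) p)

  neg-antitone-< : ∀ {x y} → x < y → - y < - x
  neg-antitone-< {x} {y} x<y = 0<y-x⇒x<y (<-respʳ-≈ eq (x<y⇒0<y-x x<y))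
    where
    eq : y - x ≈ - x - - y
    eq = solve 2 (λ x y → y :- x := :- x :- :- y) refl x y

  0<x⇒-x<0 : ∀ {x} → 0# < x → - x < 0#
  0<x⇒-x<0 p = <-respʳ-≈ -0#≈0# (neg-antitone-< p)

  -x<0⇒0<x : ∀ {x} → - x < 0# → 0# < x
  -x<0⇒0<x {x} p = <-respʳ-≈ (-‿involutive x) (<-respˡ-≈ -0#≈0# (neg-antitone-< p))

  0<-x⇒x<0 : ∀ {x} → 0# < - x → x < 0#
  0<-x⇒x<0 {x} p = <-respˡ-≈ (-‿involutive x) (<-respʳ-≈ -0#≈0# (neg-antitone-< p))

  x<0⇒0<-x : ∀ {x} → x < 0# → 0# < - x
  x<0⇒0<-x p = <-respˡ-≈ -0#≈0# (neg-antitone-< p)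

  0≤-x⇒x≤0 : ∀ {x} → 0# ≤ - x → x ≤ 0#
  0≤-x⇒x≤0 (inj₁ p) = <⇒≤ (0<-x⇒x<0 p)
  0≤-x⇒x≤0 {x} (inj₂ p) = ≤-reflexive (trans (sym (-‿involutive x)) (trans (-‿cong (sym p)) -0#≈0#))

  <0⇒-nonneg<0 : ∀ {x y} → x < 0# → 0# ≤ y → x - y < 0#
  <0⇒-nonneg<0 {x} {y} x<0 0≤y = 0<y-x⇒x<y (<-respʳ-≈ eq (0<+ (x<0⇒0<-x x<0) 0≤y))
    where
    eq : - x + y ≈ 0# - (x - y)
    eq = trans (solve 2 (λ x y → :- x :+ y := :- (x :- y)) refl x y) (sym (+-identityˡ _))

  sub-zero : ∀ x t {y} → y ≈ 0# → x - t * y ≈ x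
  sub-zero x t {y} y≈0 = begin
    x - t * y   ≈⟨ +-congˡ (-‿cong (trans (*-congˡ y≈0) (zeroʳ t))) ⟩
    x - 0#      ≈⟨ +-congˡ -0#≈0# ⟩
    x + 0#      ≈⟨ +-identityʳ x ⟩
    x           ∎

  -x*-y≈x*y : ∀ {x y} → - x * - y ≈ x * y
  -x*-y≈x*y {x} {y} = solve 2 (λ x y → (:- x) :* (:- y) := x :* y) refl x y

  0≤* : ∀ {x y} → 0# ≤ x → 0# ≤ y → 0# ≤ x * y
  0≤* (inj₁ 0<x) (inj₁ 0<y) = <⇒≤ (*-pos 0<x 0<y)
  0≤* {x} _ (inj₂ 0≈y) = ≤-reflexive (sym (trans (*-congˡ (sym 0≈y)) (zeroʳ x)))
  0≤* {y = y} (inj₂ 0≈x) _ = ≤-reflexive (sym (trans (*-congʳ (sym 0≈x)) (zeroˡ y)))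

  <0*<0 : ∀ {x y} → x < 0# → y < 0# → 0# < x * y
  <0*<0 x<0 y<0 = <-respʳ-≈ -x*-y≈x*y (*-pos (x<0⇒0<-x x<0) (x<0⇒0<-x y<0))

  <0*>0 : ∀ {x y} → x < 0# → 0# < y → x * y < 0#
  <0*>0 {x} {y} x<0 0<y =
    0<-x⇒x<0 (<-respʳ-≈ (sym (-‿distribˡ-* x y)) (*-pos (x<0⇒0<-x x<0) 0<y))

  0<x*x : ∀ {x} → ¬ (x ≈ 0#) → 0# < x * x
  0<x*x x≉0 with ≉⇒<⊎> x≉0
  ... | inj₁ x<0 = <0*<0 x<0 x<0
  ... | inj₂ 0<x = *-pos 0<x 0<x

  1≉0 : ¬ (1# ≈ 0#)
  1≉0 = <⇒≉ 0<1 ∘ sym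

  pos-cancelʳ : ∀ {x y} → 0# < y → 0# < x * y → 0# < x
  pos-cancelʳ {x} {y} 0<y 0<xy with compare 0# x
  ... | tri< 0<x _ _ = 0<x
  ... | tri≈ _ 0≈x _ = ⊥-elim (<⇒≉ 0<xy (sym (trans (*-congʳ (sym 0≈x)) (zeroˡ y))))
  ... | tri> _ _ x<0 = ⊥-elim (<-asym 0<xy (<0*>0 x<0 0<y))

  nonneg-cancelˡ : ∀ {x y} → 0# < y → 0# ≤ y * x → 0# ≤ x
  nonneg-cancelˡ {x} {y} 0<y 0≤yx = ≮⇒≥ λ x<0 →
    ≤⇒≯ 0≤yx (<-respˡ-≈ (*-comm x y) (<0*>0 x<0 0<y))

  *-monoʳ-≤ : ∀ {x y z} → 0# < z → x ≤ y → x * z ≤ y * z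
  *-monoʳ-≤ {x} {y} {z} 0<z x≤y =
    0≤y-x⇒x≤y (≤-respʳ-≈ ([y-z]x≈yx-zx z y x) (0≤* (x≤y⇒0≤y-x x≤y) (<⇒≤ 0<z)))
    where open import Algebra.Properties.Ring ring using ([y-z]x≈yx-zx)

  -- Division: a total inverse, with 0 ⁻¹ = 0.
  _⁻¹ : Carrier → Carrier
  x ⁻¹ with x ≟ 0#
  ... | yes _  = 0#
  ... | no x≉0 = proj₁ (inverse x x≉0)

  ⁻¹-inverseʳ : ∀ {x} → ¬ (x ≈ 0#) → x * x ⁻¹ ≈ 1#
  ⁻¹-inverseʳ {x} x≉0 with x ≟ 0#
  ... | yes x≈0 = ⊥-elim (x≉0 x≈0)
  ... | no x≉0′ = proj₂ (inverse x x≉0′)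

  <0⇒⁻¹<0 : ∀ {x} → x < 0# → x ⁻¹ < 0#
  <0⇒⁻¹<0 {x} x<0 with compare (x ⁻¹) 0#
  ... | tri< x⁻¹<0 _ _ = x⁻¹<0
  ... | tri≈ _ x⁻¹≈0 _ = ⊥-elim (1≉0 (trans (sym (⁻¹-inverseʳ (<⇒≉ x<0))) (trans (*-congˡ x⁻¹≈0) (zeroʳ x))))
  ... | tri> _ _ 0<x⁻¹ = ⊥-elim (<-asym 0<1 (<-respˡ-≈ (⁻¹-inverseʳ (<⇒≉ x<0)) (<0*>0 x<0 0<x⁻¹)))

  cancel-multiple : ∀ {x} y → ¬ (x ≈ 0#) → y - (y * x ⁻¹) * x ≈ 0#
  cancel-multiple {x} y x≉0 = begin
    y - (y * x ⁻¹) * x   ≈⟨ +-congˡ (-‿cong (*-assoc y (x ⁻¹) x)) ⟩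
    y - y * (x ⁻¹ * x)   ≈⟨ +-congˡ (-‿cong (*-congˡ (trans (*-comm (x ⁻¹) x) (⁻¹-inverseʳ x≉0)))) ⟩
    y - y * 1#           ≈⟨ +-congˡ (-‿cong (*-identityʳ y)) ⟩
    y - y                ≈⟨ -‿inverseʳ y ⟩
    0#                   ∎

  -- Finite sums  ∑ v = v 0 + … + v (k-1).  They agree with the library's
  -- sum, from which the algebraic laws are transported.
  ∑ : ∀ {k} → Vector Carrier k → Carrier
  ∑ = sumF F

  open import Algebra.Properties.Semiring.Sum semiring
    using (sum; sum-cong-≋; ∑-distrib-+; *-distribˡ-sum; ∑-comm; sum-replicate-zero)

  ∑≡sum : ∀ {k} (v : Vector Carrier k) → ∑ v ≡ sum v
  ∑≡sum {ℕ.zero} v = ≡.refl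
  ∑≡sum {ℕ.suc k} v = ≡.cong (v zero +_) (∑≡sum (v ∘ suc))

  ∑-cong : ∀ {k} {u v : Vector Carrier k} → (∀ i → u i ≈ v i) → ∑ u ≈ ∑ v
  ∑-cong {u = u} {v} u≈v = begin
    ∑ u    ≡⟨ ∑≡sum u ⟩
    sum u  ≈⟨ sum-cong-≋ u≈v ⟩
    sum v  ≡⟨ ∑≡sum v ⟨
    ∑ v    ∎

  ∑-zero : ∀ k → ∑ {k} (λ _ → 0#) ≈ 0#
  ∑-zero k = trans (reflexive (∑≡sum {k} (λ _ → 0#))) (sum-replicate-zero k)

  ∑-+ : ∀ {k} (u v : Vector Carrier k) → ∑ (λ i → u i + v i) ≈ ∑ u + ∑ v
  ∑-+ u v = begin
    ∑ (λ i → u i + v i)    ≡⟨ ∑≡sum (λ i → u i + v i) ⟩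
    sum (λ i → u i + v i)  ≈⟨ ∑-distrib-+ u v ⟩
    sum u + sum v          ≡⟨ ≡.cong₂ _+_ (∑≡sum u) (∑≡sum v) ⟨
    ∑ u + ∑ v              ∎

  ∑-*ˡ : ∀ {k} t (v : Vector Carrier k) → ∑ (λ i → t * v i) ≈ t * ∑ v
  ∑-*ˡ t v = begin
    ∑ (λ i → t * v i)    ≡⟨ ∑≡sum (λ i → t * v i) ⟩
    sum (λ i → t * v i)  ≈⟨ *-distribˡ-sum t v ⟨
    t * sum v            ≡⟨ ≡.cong (t *_) (∑≡sum v) ⟨
    t * ∑ v              ∎

  ∑-swap : ∀ {k l : ℕ} (M : Fin k → Fin l → Carrier) →
           ∑ (λ i → ∑ (λ j → M i j)) ≈ ∑ (λ j → ∑ (λ i → M i j))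
  ∑-swap M = begin
    ∑ (λ i → ∑ (M i))              ≈⟨ ∑-cong (λ i → reflexive (∑≡sum (M i))) ⟩
    ∑ (λ i → sum (M i))            ≡⟨ ∑≡sum (λ i → sum (M i)) ⟩
    sum (λ i → sum (M i))          ≈⟨ ∑-comm M ⟩
    sum (λ j → sum (λ i → M i j))  ≡⟨ ∑≡sum (λ j → sum (λ i → M i j)) ⟨
    ∑ (λ j → sum (λ i → M i j))    ≈⟨ ∑-cong (λ j → reflexive (∑≡sum (λ i → M i j))) ⟨
    ∑ (λ j → ∑ (λ i → M i j))      ∎

  ∑-lin : ∀ {k} t (u v : Vector Carrier k) → ∑ (λ i → u i - t * v i) ≈ ∑ u - t * ∑ v
  ∑-lin t u v = begin
    ∑ (λ i → u i - t * v i)      ≈⟨ ∑-cong (λ i → +-congˡ (-‿distribˡ-* t (v i))) ⟩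
    ∑ (λ i → u i + - t * v i)    ≈⟨ ∑-+ u (λ i → - t * v i) ⟩
    ∑ u + ∑ (λ i → - t * v i)    ≈⟨ +-congˡ (∑-*ˡ (- t) v) ⟩
    ∑ u + - t * ∑ v              ≈⟨ +-congˡ (-‿distribˡ-* t (∑ v)) ⟨
    ∑ u - t * ∑ v                ∎

  ∑-split : ∀ {m n} (v : Vector Carrier (m ℕ.+ n)) →
            ∑ v ≈ ∑ (λ i → v (i ↑ˡ n)) + ∑ (λ i → v (m ↑ʳ i))
  ∑-split {ℕ.zero} v = sym (+-identityˡ (∑ v))
  ∑-split {ℕ.suc m} {n} v = trans (+-congˡ (∑-split {m} {n} (v ∘ suc))) (sym (+-assoc _ _ _))

  ∑-nonneg : ∀ {k} {v : Vector Carrier k} → (∀ i → 0# ≤ v i) → 0# ≤ ∑ v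
  ∑-nonneg {ℕ.zero} _ = ≤-refl
  ∑-nonneg {ℕ.suc k} 0≤v = 0≤+ (0≤v zero) (∑-nonneg (0≤v ∘ suc))

  ∑-pos : ∀ {k} {v : Vector Carrier k} → (∀ i → 0# ≤ v i) → ∀ j → 0# < v j → 0# < ∑ v
  ∑-pos {ℕ.suc k} 0≤v zero 0<v₀ = 0<+ 0<v₀ (∑-nonneg (0≤v ∘ suc))
  ∑-pos {ℕ.suc k} {v} 0≤v (suc j) 0<vⱼ =
    <-respʳ-≈ (+-comm _ (v zero)) (0<+ (∑-pos (0≤v ∘ suc) j 0<vⱼ) (0≤v zero))

  ∑-nonzero : ∀ {k} (v : Vector Carrier k) → ¬ (∑ v ≈ 0#) → ∃ λ i → ¬ (v i ≈ 0#)
  ∑-nonzero {ℕ.zero} v ∑v≉0 = ⊥-elim (∑v≉0 refl)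
  ∑-nonzero {ℕ.suc k} v ∑v≉0 with v zero ≟ 0#
  ... | no v₀≉0 = zero , v₀≉0
  ... | yes v₀≈0 =
    let (i , vᵢ≉0) = ∑-nonzero (v ∘ suc) λ ∑≈0 → ∑v≉0 (trans (+-cong v₀≈0 ∑≈0) (+-identityʳ 0#))
    in suc i , vᵢ≉0

  infixl 6 _-[_]_
  _-[_]_ : ∀ {k} → Vector Carrier k → Carrier → Vector Carrier k → Vector Carrier k
  (u -[ t ] v) i = u i - t * v i

  infix 7 _·_
  _·_ : ∀ {k} → Vector Carrier k → Vector Carrier k → Carrier
  u · v = ∑ (λ j → u j * v j)

  ·-comm : ∀ {k} (u v : Vector Carrier k) → u · v ≈ v · u
  ·-comm u v = ∑-cong (λ j → *-comm (u j) (v j))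

  ·-linearˡ : ∀ {k} (u v y : Vector Carrier k) t → (u -[ t ] v) · y ≈ u · y - t * (v · y)
  ·-linearˡ u v y t = trans
    (∑-cong (λ j → solve 4 (λ a b t y → (a :- t :* b) :* y := a :* y :- t :* (b :* y))
                           refl (u j) (v j) t (y j)))
    (∑-lin t (λ j → u j * y j) (λ j → v j * y j))

  ·-linearʳ : ∀ {k} (u y z : Vector Carrier k) t → u · (y -[ t ] z) ≈ u · y - t * (u · z)
  ·-linearʳ u y z t = trans (·-comm u (y -[ t ] z))
    (trans (·-linearˡ y z u t) (+-cong (·-comm y u) (-‿cong (*-congˡ (·-comm z u)))))

  minimiser : ∀ {k p} {Q : Pred (Fin k) p} → Decidable Q → (r : Fin k → Carrier) →
              ∀ {j} → Q j → Σ (Fin k) λ i₀ → Q i₀ × (∀ i → Q i → r i₀ ≤ r i)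
  minimiser {k} Q? r {j} Qj =
    i₀ , argmin-all r Qj (all-filter Q? (allFin k)) ,
    λ i Qi → All.lookup (f[argmin]≤f[xs] j candidates) (∈-filter⁺ Q? (∈-allFin i) Qi)
    where
    open import Data.List.Extrema totalOrder using (argmin; argmin-all; f[argmin]≤f[xs])
    candidates : List (Fin k)
    candidates = filter Q? (allFin k)
    i₀ : Fin k
    i₀ = argmin r j candidates

module Farkas {c ℓ₁ ℓ₂ : Level} (F : OrderedField c ℓ₁ ℓ₂) where
  open OrderedField F hiding (_<_; zero)
  open OrderedFieldProperties F
  open import Relation.Binary.Reasoning.Setoid setoid

  Separating : ∀ {m D} → (Fin m → Vector Carrier D) → Vector Carrier D → Set (c ⊔ ℓ₁ ⊔ ℓ₂)
  Separating {D = D} f g = Σ (Vector Carrier D) λ x → (∀ i → 0# ≤ f i · x) × g · x < 0#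

  NonnegativeCombination : ∀ {m D} → (Fin m → Vector Carrier D) → Vector Carrier D → Set (c ⊔ ℓ₁ ⊔ ℓ₂)
  NonnegativeCombination {m} f g =
    Σ (Vector Carrier m) λ λ′ → (∀ i → 0# ≤ λ′ i) × (∀ j → g j ≈ ∑ (λ i → λ′ i * f i j))

  -- One step of Fourier–Motzkin elimination.
  -- Projecting along f₀ onto the hyperplane x⊥ gives a system with one row
  -- fewer, and either outcome of Farkas' lemma for it lifts back.
  module Elimination {m D} (f : Fin (ℕ.suc m) → Vector Carrier D) (g x : Vector Carrier D)
                     (rows-nonneg : ∀ i → 0# ≤ f (suc i) · x) (g·x<0 : g · x < 0#)
                     (f₀·x<0 : f zero · x < 0#) where
    f₀ : Vector Carrier D
    f₀ = f zero

    ι : Carrier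
    ι = (f₀ · x) ⁻¹

    f₀·x*ι≈1 : (f₀ · x) * ι ≈ 1#
    f₀·x*ι≈1 = ⁻¹-inverseʳ (<⇒≉ f₀·x<0)

    -- π v is the vector v − (v·x / f₀·x) f₀, which is orthogonal to x.
    π : Vector Carrier D → Vector Carrier D
    π v = v -[ (v · x) * ι ] f₀

    lift : Vector Carrier D → Vector Carrier D
    lift y = y -[ (f₀ · y) * ι ] x

    lift-adjoint : ∀ v y → v · lift y ≈ π v · y
    lift-adjoint v y = begin
      v · lift y                        ≈⟨ ·-linearʳ v y x ((f₀ · y) * ι) ⟩
      v · y - ((f₀ · y) * ι) * (v · x)  ≈⟨ +-congˡ (-‿cong (solve 3 (λ a b ι → (a :* ι) :* b := (b :* ι) :* a)
                                                              refl (f₀ · y) (v · x) ι)) ⟩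
      v · y - ((v · x) * ι) * (f₀ · y)  ≈⟨ ·-linearˡ v f₀ y ((v · x) * ι) ⟨
      π v · y                           ∎

    π-f₀ : ∀ y → π f₀ · y ≈ 0#
    π-f₀ y = begin
      π f₀ · y                           ≈⟨ ·-linearˡ f₀ f₀ y ((f₀ · x) * ι) ⟩
      f₀ · y - ((f₀ · x) * ι) * (f₀ · y) ≈⟨ +-congˡ (-‿cong (trans (*-congʳ f₀·x*ι≈1) (*-identityˡ (f₀ · y)))) ⟩
      f₀ · y - f₀ · y                    ≈⟨ -‿inverseʳ (f₀ · y) ⟩
      0#                                 ∎

    lift-separating : Separating (π ∘ f ∘ suc) (π g) → Separating f g
    lift-separating (y , π-rows-nonneg , π-g·y<0) = lift y , rows , <-respˡ-≈ (sym (lift-adjoint g y)) π-g·y<0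
      where
      rows : ∀ i → 0# ≤ f i · lift y
      rows zero    = ≤-reflexive (sym (trans (lift-adjoint f₀ y) (π-f₀ y)))
      rows (suc i) = ≤-respʳ-≈ (sym (lift-adjoint (f (suc i)) y)) (π-rows-nonneg i)

    lift-combination : NonnegativeCombination (π ∘ f ∘ suc) (π g) → NonnegativeCombination f g
    lift-combination (λ′ , λ′-nonneg , π-g≈) = λ″ , λ″-nonneg , g≈
      where
      S : Carrier
      S = ∑ (λ i → λ′ i * (f (suc i) · x))

      λ₀ : Carrier
      λ₀ = (g · x - S) * ι

      λ″ : Vector Carrier (ℕ.suc m)
      λ″ zero    = λ₀
      λ″ (suc i) = λ′ i

      λ″-nonneg : ∀ i → 0# ≤ λ″ i
      λ″-nonneg zero    = <⇒≤ (<0*<0 (<0⇒-nonneg<0 g·x<0 S-nonneg) (<0⇒⁻¹<0 f₀·x<0))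
        where
        S-nonneg : 0# ≤ S
        S-nonneg = ∑-nonneg (λ i → 0≤* (λ′-nonneg i) (rows-nonneg i))
      λ″-nonneg (suc i) = λ′-nonneg i

      g≈ : ∀ j → g j ≈ ∑ (λ i → λ″ i * f i j)
      g≈ j = begin
        g j                                                     ≈⟨ solve 2 (λ g k → g := (g :- k) :+ k) refl (g j) k ⟩
        π g j + k                                               ≈⟨ +-congʳ (π-g≈ j) ⟩
        ∑ (λ i → λ′ i * π (f (suc i)) j) + k                    ≈⟨ +-congʳ (∑-cong expand) ⟩
        ∑ (λ i → λ′ i * f (suc i) j - (ι * f₀ j) * sᵢ i) + k   ≈⟨ +-congʳ (∑-lin (ι * f₀ j) (λ i → λ′ i * f (suc i) j) sᵢ) ⟩
        (∑ (λ i → λ′ i * f (suc i) j) - (ι * f₀ j) * S) + k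
          ≈⟨ solve 5 (λ A ι c S X → (A :- (ι :* c) :* S) :+ (X :* ι) :* c := ((X :- S) :* ι) :* c :+ A)
                     refl (∑ (λ i → λ′ i * f (suc i) j)) ι (f₀ j) S (g · x) ⟩
        λ₀ * f₀ j + ∑ (λ i → λ′ i * f (suc i) j)                ∎
        where
        k : Carrier
        k = ((g · x) * ι) * f₀ j
        sᵢ : Fin m → Carrier
        sᵢ i = λ′ i * (f (suc i) · x)
        expand : ∀ i → λ′ i * π (f (suc i)) j ≈ λ′ i * f (suc i) j - (ι * f₀ j) * sᵢ i
        expand i = solve 5 (λ l a b ι c → l :* (a :- (b :* ι) :* c) := l :* a :- (ι :* c) :* (l :* b))
                           refl (λ′ i) (f (suc i) j) (f (suc i) · x) ι (f₀ j)

  -- With no rows, either g = 0 or x = −g separates: g · (−g) = −(g · g) < 0.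
  farkas-empty : ∀ {D} (f : Fin ℕ.zero → Vector Carrier D) (g : Vector Carrier D) →
                 Separating f g ⊎ NonnegativeCombination f g
  farkas-empty f g with any? (λ j → ¬? (g j ≟ 0#))
  ... | yes (j , gⱼ≉0) = inj₁ ((λ k → - g k) , (λ ()) , g·-g<0)
    where
    g·g>0 : 0# < g · g
    g·g>0 = ∑-pos (λ k → square-nonneg (g k)) j (0<x*x gⱼ≉0)
      where
      square-nonneg : ∀ y → 0# ≤ y * y
      square-nonneg y with y ≟ 0#
      ... | yes y≈0 = ≤-reflexive (sym (trans (*-congʳ y≈0) (zeroˡ y)))
      ... | no y≉0  = <⇒≤ (0<x*x y≉0)
    g·-g<0 : g · (λ k → - g k) < 0#
    g·-g<0 = <-respˡ-≈ (sym g·-g≈-g·g) (0<x⇒-x<0 g·g>0)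
      where
      g·-g≈-g·g : g · (λ k → - g k) ≈ - (g · g)
      g·-g≈-g·g = begin
        ∑ (λ k → g k * - g k)      ≈⟨ ∑-cong (λ k → trans (sym (-‿distribʳ-* (g k) (g k))) (sym (-1*x≈-x _))) ⟩
        ∑ (λ k → - 1# * (g k * g k)) ≈⟨ ∑-*ˡ (- 1#) (λ k → g k * g k) ⟩
        - 1# * (g · g)             ≈⟨ -1*x≈-x (g · g) ⟩
        - (g · g)                  ∎
  ... | no none = inj₂ ((λ ()) , (λ ()) , λ j → decidable-stable (g j ≟ 0#) (λ gⱼ≉0 → none (j , gⱼ≉0)))

  farkas : ∀ {m D} (f : Fin m → Vector Carrier D) (g : Vector Carrier D) →
           Separating f g ⊎ NonnegativeCombination f g
  farkas {ℕ.zero} f g = farkas-empty f g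
  farkas {ℕ.suc m} f g with farkas (f ∘ suc) g
  ... | inj₂ (λ′ , λ′-nonneg , g≈) = inj₂ (λ″ , λ″-nonneg , g≈′)
    where
    λ″ : Vector Carrier (ℕ.suc m)
    λ″ zero    = 0#
    λ″ (suc i) = λ′ i
    λ″-nonneg : ∀ i → 0# ≤ λ″ i
    λ″-nonneg zero    = ≤-refl
    λ″-nonneg (suc i) = λ′-nonneg i
    g≈′ : ∀ j → g j ≈ ∑ (λ i → λ″ i * f i j)
    g≈′ j = trans (g≈ j) (sym (trans (+-congʳ (zeroˡ (f zero j))) (+-identityˡ _)))
  ... | inj₁ (x , rows-nonneg , g·x<0) with f zero · x <? 0#
  ...   | no f₀·x≮0 = inj₁ (x , rows , g·x<0)
    where
    rows : ∀ i → 0# ≤ f i · x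
    rows zero    = ≮⇒≥ f₀·x≮0
    rows (suc i) = rows-nonneg i
  ...   | yes f₀·x<0 = map-⊎ lift-separating lift-combination (farkas (π ∘ f ∘ suc) (π g))
    where open Elimination f g x rows-nonneg g·x<0 f₀·x<0

subsetOf : ∀ {n p} {P : Pred (Fin n) p} → Decidable P → Subset n
subsetOf P? = tabulate (does ∘ P?)

∈-subsetOf⁺ : ∀ {n p} {P : Pred (Fin n) p} (P? : Decidable P) {i} → P i → i ∈ subsetOf P?
∈-subsetOf⁺ P? {i} Pi = lookup⇒[]= i _ (≡.trans (lookup∘tabulate (does ∘ P?) i) (dec-true (P? i) Pi))

∈-subsetOf⁻ : ∀ {n p} {P : Pred (Fin n) p} (P? : Decidable P) {i} → i ∈ subsetOf P? → P i
∈-subsetOf⁻ {P = P} P? {i} i∈ = decided (P? i) (≡.trans (≡.sym (lookup∘tabulate (does ∘ P?) i)) ([]=⇒lookup i∈))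
  where
  decided : (d : Dec (P i)) → does d ≡ true → P i
  decided (yes Pi) _ = Pi
  decided (no _)   ()

-- The sign required of the separating functional at a point: positive,
-- negative, zero (on the hyperplane), or unconstrained.
data Sign : Set where
  pos neg hyp free : Sign

data Strict : Sign → Set where
  pos : Strict pos
  neg : Strict neg

strict? : Decidable Strict
strict? pos  = yes pos
strict? neg  = yes neg
strict? hyp  = no λ ()
strict? free = no λ ()

-- Signs of points that may occur in C⁺ (resp. C⁻) of a circuit compatible
-- with a separation.
data Admits⁺ : Sign → Set where
  pos : Admits⁺ pos
  hyp : Admits⁺ hyp

data Admits⁻ : Sign → Set where
  neg : Admits⁻ neg
  hyp : Admits⁻ hyp

module AffineDependences {c ℓ₁ ℓ₂ : Level} (F : OrderedField c ℓ₁ ℓ₂) {d n : ℕ} (A : Config F d n) where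
  open OrderedField F hiding (_<_; zero)
  open OrderedFieldProperties F
  open import Relation.Binary.Reasoning.Setoid setoid

  Dependence : Vector Carrier n → Set ℓ₁
  Dependence = IsAffineDependence F A

  dependence-lin : ∀ {μ ν} → Dependence μ → Dependence ν → ∀ t → Dependence (μ -[ t ] ν)
  dependence-lin {μ} {ν} (μA≈0 , ∑μ≈0) (νA≈0 , ∑ν≈0) t =
    (λ j → trans (·-linearˡ μ ν (λ i → A i j) t) (vanish (μA≈0 j) (νA≈0 j))) ,
    trans (∑-lin t μ ν) (vanish ∑μ≈0 ∑ν≈0)
    where
    vanish : ∀ {x y} → x ≈ 0# → y ≈ 0# → x - t * y ≈ 0#
    vanish {x} x≈0 y≈0 = trans (sub-zero x t y≈0) x≈0

  dependence-scale : ∀ {ν} → Dependence ν → ∀ t → Dependence (λ i → t * ν i)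
  dependence-scale {ν} (νA≈0 , ∑ν≈0) t =
    (λ j → trans (∑-cong (λ i → *-assoc t (ν i) (A i j))) (scaled (∑-*ˡ t (λ i → ν i * A i j)) (νA≈0 j))) ,
    scaled (∑-*ˡ t ν) ∑ν≈0
    where
    scaled : ∀ {x y} → x ≈ t * y → y ≈ 0# → x ≈ 0#
    scaled x≈ty y≈0 = trans x≈ty (trans (*-congˡ y≈0) (zeroʳ t))

  -- Σ μᵢ (w · aᵢ + b) = w · (Σ μᵢ aᵢ) + b Σ μᵢ = 0.
  dependence-annihilates : ∀ {μ} → Dependence μ → ∀ f → ∑ (λ i → μ i * evalAff F f (A i)) ≈ 0#
  dependence-annihilates {μ} (μA≈0 , ∑μ≈0) (w , b) = begin
    ∑ (λ i → μ i * evalAff F (w , b) (A i))                    ≈⟨ ∑-cong expand ⟩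
    ∑ (λ i → ∑ (λ j → w j * (μ i * A i j)) + b * μ i)          ≈⟨ ∑-+ _ (λ i → b * μ i) ⟩
    ∑ (λ i → ∑ (λ j → w j * (μ i * A i j))) + ∑ (λ i → b * μ i) ≈⟨ +-cong (∑-swap (λ i j → w j * (μ i * A i j))) (∑-*ˡ b μ) ⟩
    ∑ (λ j → ∑ (λ i → w j * (μ i * A i j))) + b * ∑ μ          ≈⟨ +-cong (∑-cong column) (trans (*-congˡ ∑μ≈0) (zeroʳ b)) ⟩
    ∑ {d} (λ _ → 0#) + 0#                                       ≈⟨ trans (+-identityʳ _) (∑-zero d) ⟩
    0#                                                          ∎
    where
    expand : ∀ i → μ i * evalAff F (w , b) (A i) ≈ ∑ (λ j → w j * (μ i * A i j)) + b * μ i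
    expand i = begin
      μ i * (∑ (λ j → w j * A i j) + b)          ≈⟨ distribˡ (μ i) _ b ⟩
      μ i * ∑ (λ j → w j * A i j) + μ i * b      ≈⟨ +-cong (sym (∑-*ˡ (μ i) (λ j → w j * A i j))) (*-comm (μ i) b) ⟩
      ∑ (λ j → μ i * (w j * A i j)) + b * μ i    ≈⟨ +-congʳ (∑-cong (λ j → solve 3 (λ m w a → m :* (w :* a) := w :* (m :* a))
                                                                                 refl (μ i) (w j) (A i j))) ⟩
      ∑ (λ j → w j * (μ i * A i j)) + b * μ i    ∎
    column : ∀ j → ∑ (λ i → w j * (μ i * A i j)) ≈ 0#
    column j = trans (∑-*ˡ (w j) (λ i → μ i * A i j)) (trans (*-congˡ (μA≈0 j)) (zeroʳ (w j)))

module ConformalCircuits {c ℓ₁ ℓ₂ : Level} (F : OrderedField c ℓ₁ ℓ₂) {d n : ℕ}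
                         (A : Config F d n) (σ : Fin n → Sign) where
  open OrderedField F hiding (_<_; zero)
  open OrderedFieldProperties F
  open AffineDependences F A
  open import Algebra.Properties.Ring ring using (x∙y⁻¹≈ε⇒x≈y)
  open import Relation.Binary.Reasoning.Setoid setoid

  ε : Sign → Carrier
  ε pos  = 1#
  ε neg  = - 1#
  ε hyp  = 0#
  ε free = 0#

  ε-nonzero : ∀ {s x} → Strict s → ¬ (x ≈ 0#) → ¬ (ε s * x ≈ 0#)
  ε-nonzero {x = x} pos x≉0 e = x≉0 (trans (sym (*-identityˡ x)) e)
  ε-nonzero {x = x} neg x≉0 e =
    x≉0 (trans (sym (-‿involutive x)) (trans (-‿cong (trans (sym (-1*x≈-x x)) e)) -0#≈0#))

  record Conformal (μ : Vector Carrier n) : Set (c ⊔ ℓ₁ ⊔ ℓ₂) where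
    field
      dependence : Dependence μ
      vanishes   : ∀ i → σ i ≡ free → μ i ≈ 0#
      oriented   : ∀ i → Strict (σ i) → 0# ≤ ε (σ i) * μ i
      witness    : Σ (Fin n) λ i → Strict (σ i) × ¬ (μ i ≈ 0#)

  ConformalCircuit : Set (c ⊔ ℓ₁ ⊔ ℓ₂)
  ConformalCircuit =
    Σ (Subset n) λ C⁺ → Σ (Subset n) λ C⁻ →
      IsCircuit F A C⁺ C⁻
      × (∀ {i} → i ∈ C⁺ → Admits⁺ (σ i))
      × (∀ {i} → i ∈ C⁻ → Admits⁻ (σ i))
      × Σ (Fin n) (λ i → i ∈ C⁺ ∪ C⁻ × Strict (σ i))

  positives negatives support : Vector Carrier n → Subset n
  positives μ = subsetOf (λ i → 0# <? μ i)
  negatives μ = subsetOf (λ i → μ i <? 0#)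
  support μ   = positives μ ∪ negatives μ

  ∈-support⁺ : ∀ {μ i} → ¬ (μ i ≈ 0#) → i ∈ support μ
  ∈-support⁺ {μ} μᵢ≉0 with ≉⇒<⊎> μᵢ≉0
  ... | inj₁ μᵢ<0 = x∈p∪q⁺ (inj₂ (∈-subsetOf⁺ (λ i → μ i <? 0#) μᵢ<0))
  ... | inj₂ 0<μᵢ = x∈p∪q⁺ (inj₁ (∈-subsetOf⁺ (λ i → 0# <? μ i) 0<μᵢ))

  ∈-support⁻ : ∀ {μ i} → i ∈ support μ → ¬ (μ i ≈ 0#)
  ∈-support⁻ {μ} i∈ with x∈p∪q⁻ (positives μ) (negatives μ) i∈
  ... | inj₁ i∈pos = <⇒≉ (∈-subsetOf⁻ (λ i → 0# <? μ i) i∈pos) ∘ sym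
  ... | inj₂ i∈neg = <⇒≉ (∈-subsetOf⁻ (λ i → μ i <? 0#) i∈neg)

  ∉-support : ∀ {μ} i → i ∉ support μ → μ i ≈ 0#
  ∉-support {μ} i i∉ = decidable-stable (μ i ≟ 0#) (i∉ ∘ ∈-support⁺)

  infix 4 _⊏_
  _⊏_ : Vector Carrier n → Vector Carrier n → Set ℓ₁
  ν ⊏ μ = (∀ i → μ i ≈ 0# → ν i ≈ 0#) × Σ (Fin n) λ i → ¬ (μ i ≈ 0#) × ν i ≈ 0#

  ⊏⇒∣support∣< : ∀ {μ ν} → ν ⊏ μ → ∣ support ν ∣ ℕ.< ∣ support μ ∣
  ⊏⇒∣support∣< {μ} {ν} (ν≤μ , x , μₓ≉0 , νₓ≈0) = p⊂q⇒∣p∣<∣q∣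
    ((λ {i} i∈ν → ∈-support⁺ λ μᵢ≈0 → ∈-support⁻ i∈ν (ν≤μ i μᵢ≈0)) ,
     x , ∈-support⁺ μₓ≉0 , λ x∈ν → ∈-support⁻ x∈ν νₓ≈0)

  circuit-of : ∀ {μ} → Conformal μ → (∀ T → T ⊂ support μ → ¬ AffinelyDependent F A T) → ConformalCircuit
  circuit-of {μ} cμ minimal =
    positives μ , negatives μ ,
    ( (λ i i∈pos i∈neg → <-asym (∈-subsetOf⁻ 0<? i∈pos) (∈-subsetOf⁻ <0? i∈neg))
    , ((μ , dependence , ∉-support , w , μ-w≉0) , minimal)
    , μ , dependence , ∉-support , (λ i → ∈-subsetOf⁻ 0<?) , (λ i → ∈-subsetOf⁻ <0?) )
    , (λ {i} i∈ → admits⁺ (σ i) (vanishes i) (oriented i) (∈-subsetOf⁻ 0<? i∈))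
    , (λ {i} i∈ → admits⁻ (σ i) (vanishes i) (oriented i) (∈-subsetOf⁻ <0? i∈))
    , w , ∈-support⁺ μ-w≉0 , strict-w
    where
    open Conformal cμ
    w : Fin n
    w = proj₁ witness
    strict-w : Strict (σ w)
    strict-w = proj₁ (proj₂ witness)
    μ-w≉0 : ¬ (μ w ≈ 0#)
    μ-w≉0 = proj₂ (proj₂ witness)
    0<? : Decidable (λ i → 0# < μ i)
    0<? i = 0# <? μ i
    <0? : Decidable (λ i → μ i < 0#)
    <0? i = μ i <? 0#

    admits⁺ : ∀ {x} s → (s ≡ free → x ≈ 0#) → (Strict s → 0# ≤ ε s * x) → 0# < x → Admits⁺ s
    admits⁺ pos  _ _ _ = pos
    admits⁺ hyp  _ _ _ = hyp
    admits⁺ neg  _ oriented′ 0<x =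
      ⊥-elim (≤⇒≯ (oriented′ neg) (<-respˡ-≈ (sym (-1*x≈-x _)) (0<x⇒-x<0 0<x)))
    admits⁺ free vanishes′ _ 0<x = ⊥-elim (<⇒≉ 0<x (sym (vanishes′ ≡.refl)))

    admits⁻ : ∀ {x} s → (s ≡ free → x ≈ 0#) → (Strict s → 0# ≤ ε s * x) → x < 0# → Admits⁻ s
    admits⁻ neg  _ _ _ = neg
    admits⁻ hyp  _ _ _ = hyp
    admits⁻ pos  _ oriented′ x<0 = ⊥-elim (≤⇒≯ (oriented′ pos) (<-respˡ-≈ (sym (*-identityˡ _)) x<0))
    admits⁻ free vanishes′ _ x<0 = ⊥-elim (<⇒≉ x<0 (vanishes′ ≡.refl))

  -- Shrinking by a dependence ν ⊏ μ that vanishes at all strict points: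
  -- subtract the multiple of ν that kills a coordinate j with νⱼ ≠ 0.
  shrink-hyperplane : ∀ {μ ν j} → Conformal μ → Dependence ν → ν ⊏ μ →
                      (∀ i → Strict (σ i) → ν i ≈ 0#) → ¬ (ν j ≈ 0#) →
                      Σ (Vector Carrier n) λ μ′ → Conformal μ′ × μ′ ⊏ μ
  shrink-hyperplane {μ} {ν} {j} cμ dν (ν≤μ , _) ν-strict≈0 νⱼ≉0 =
    μ′ , cμ′ , (λ i μᵢ≈0 → trans (unchanged (ν≤μ i μᵢ≈0)) μᵢ≈0) , j , μⱼ≉0 , cancel-multiple (μ j) νⱼ≉0
    where
    open Conformal cμ
    t : Carrier
    t = μ j * ν j ⁻¹
    μ′ : Vector Carrier n
    μ′ = μ -[ t ] ν
    unchanged : ∀ {i} → ν i ≈ 0# → μ′ i ≈ μ i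
    unchanged {i} = sub-zero (μ i) t
    μⱼ≉0 : ¬ (μ j ≈ 0#)
    μⱼ≉0 μⱼ≈0 = νⱼ≉0 (ν≤μ j μⱼ≈0)
    cμ′ : Conformal μ′
    cμ′ = record
      { dependence = dependence-lin dependence dν t
      ; vanishes   = λ i σᵢ≡free → trans (unchanged (ν≤μ i (vanishes i σᵢ≡free))) (vanishes i σᵢ≡free)
      ; oriented   = λ i s → ≤-respʳ-≈ (*-congˡ (sym (unchanged (ν-strict≈0 i s)))) (oriented i s)
      ; witness    = let (w , s , μ-w≉0) = witness
                     in w , s , λ μ′-w≈0 → μ-w≉0 (trans (sym (unchanged (ν-strict≈0 w s))) μ′-w≈0)
      }

  -- Shrinking by a dependence ν ⊏ μ that is nonzero at a strict point k
  -- (the ratio test): rescale ν to κ with ε κₖ > 0, let t be the least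
  -- ratio μᵢ / κᵢ over strict i with ε κᵢ > 0, and pass to μ′ = μ − t κ.
  -- μ′ is again oriented and vanishes at the minimising index; if μ′ still
  -- meets a strict point it is the smaller conformal dependence, and
  -- otherwise μ = t κ on strict points, so κ itself is conformal.
  module RatioTest {μ ν k} (cμ : Conformal μ) (dν : Dependence ν) (ν⊏μ : ν ⊏ μ)
                   (strict-k : Strict (σ k)) (νₖ≉0 : ¬ (ν k ≈ 0#)) where
    open Conformal cμ

    ν≤μ : ∀ i → μ i ≈ 0# → ν i ≈ 0#
    ν≤μ = proj₁ ν⊏μ

    κ : Vector Carrier n
    κ i = (ε (σ k) * ν k) * ν i

    κ≤ν : ∀ i → ν i ≈ 0# → κ i ≈ 0#
    κ≤ν i νᵢ≈0 = trans (*-congˡ νᵢ≈0) (zeroʳ _)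

    εκ : Fin n → Carrier
    εκ i = ε (σ i) * κ i

    εκ≉0 : ∀ {i} → 0# < εκ i → ¬ (κ i ≈ 0#)
    εκ≉0 {i} 0<εκᵢ κᵢ≈0 = <⇒≉ 0<εκᵢ (sym (trans (*-congˡ κᵢ≈0) (zeroʳ _)))

    0<εκₖ : 0# < εκ k
    0<εκₖ = <-respʳ-≈ (solve 2 (λ s v → (s :* v) :* (s :* v) := s :* ((s :* v) :* v)) refl (ε (σ k)) (ν k))
                      (0<x*x (ε-nonzero strict-k νₖ≉0))

    ratio : Fin n → Carrier
    ratio i = μ i * κ i ⁻¹

    ratio-spec : ∀ i → ¬ (κ i ≈ 0#) → ratio i * εκ i ≈ ε (σ i) * μ i
    ratio-spec i κᵢ≉0 = begin
      (μ i * κ i ⁻¹) * (ε (σ i) * κ i)  ≈⟨ solve 4 (λ m ι s k → (m :* ι) :* (s :* k) := (s :* m) :* (k :* ι))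
                                                   refl (μ i) (κ i ⁻¹) (ε (σ i)) (κ i) ⟩
      (ε (σ i) * μ i) * (κ i * κ i ⁻¹)  ≈⟨ *-congˡ (⁻¹-inverseʳ κᵢ≉0) ⟩
      (ε (σ i) * μ i) * 1#              ≈⟨ *-identityʳ _ ⟩
      ε (σ i) * μ i                     ∎

    Candidate : Pred (Fin n) ℓ₂
    Candidate i = Strict (σ i) × 0# < εκ i

    least : Σ (Fin n) λ i₀ → Candidate i₀ × (∀ i → Candidate i → ratio i₀ ≤ ratio i)
    least = minimiser (λ i → strict? (σ i) ×-dec (0# <? εκ i)) ratio (strict-k , 0<εκₖ)

    i₀ : Fin n
    i₀ = proj₁ least

    t : Carrier
    t = ratio i₀

    κ₀≉0 : ¬ (κ i₀ ≈ 0#)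
    κ₀≉0 = εκ≉0 (proj₂ (proj₁ (proj₂ least)))

    μ₀≉0 : ¬ (μ i₀ ≈ 0#)
    μ₀≉0 μ₀≈0 = κ₀≉0 (κ≤ν i₀ (ν≤μ i₀ μ₀≈0))

    0<t : 0# < t
    0<t = pos-cancelʳ 0<εκ₀ (<-respʳ-≈ (sym (ratio-spec i₀ κ₀≉0)) 0<εμ₀)
      where
      strict₀ : Strict (σ i₀)
      strict₀ = proj₁ (proj₁ (proj₂ least))
      0<εκ₀ : 0# < εκ i₀
      0<εκ₀ = proj₂ (proj₁ (proj₂ least))
      0<εμ₀ : 0# < ε (σ i₀) * μ i₀
      0<εμ₀ with oriented i₀ strict₀
      ... | inj₁ 0<εμ₀ = 0<εμ₀
      ... | inj₂ 0≈εμ₀ = ⊥-elim (ε-nonzero strict₀ μ₀≉0 (sym 0≈εμ₀))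

    μ′ : Vector Carrier n
    μ′ = μ -[ t ] κ

    εμ′ : ∀ i → ε (σ i) * μ′ i ≈ ε (σ i) * μ i - t * εκ i
    εμ′ i = solve 4 (λ s m t k → s :* (m :- t :* k) := s :* m :- t :* (s :* k)) refl (ε (σ i)) (μ i) t (κ i)

    -- t is at most every candidate ratio, so t · εκᵢ ≤ εμᵢ at strict points.
    tεκ≤εμ : ∀ i → Strict (σ i) → t * εκ i ≤ ε (σ i) * μ i
    tεκ≤εμ i sᵢ with 0# <? εκ i
    ... | yes 0<εκᵢ = ≤-respʳ-≈ (ratio-spec i (εκ≉0 0<εκᵢ))
                        (*-monoʳ-≤ 0<εκᵢ (proj₂ (proj₂ least) i (sᵢ , 0<εκᵢ)))
    ... | no εκᵢ≮0  = ≤-trans (≤-respˡ-≈ (*-comm (εκ i) t) (≤-respʳ-≈ (zeroˡ t) (*-monoʳ-≤ 0<t (≮⇒≥ εκᵢ≮0))))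
                              (oriented i sᵢ)

    μ′-vanishes : ∀ i → μ i ≈ 0# → μ′ i ≈ 0#
    μ′-vanishes i μᵢ≈0 = trans (sub-zero (μ i) t (κ≤ν i (ν≤μ i μᵢ≈0))) μᵢ≈0

    μ′⊏μ : μ′ ⊏ μ
    μ′⊏μ = μ′-vanishes , i₀ , μ₀≉0 , cancel-multiple (μ i₀) κ₀≉0

    conformal-μ′ : Σ (Fin n) (λ i → Strict (σ i) × ¬ (μ′ i ≈ 0#)) → Conformal μ′
    conformal-μ′ w = record
      { dependence = dependence-lin dependence (dependence-scale dν (ε (σ k) * ν k)) t
      ; vanishes   = λ i σᵢ≡free → μ′-vanishes i (vanishes i σᵢ≡free)
      ; oriented   = λ i sᵢ → ≤-respʳ-≈ (sym (εμ′ i)) (x≤y⇒0≤y-x (tεκ≤εμ i sᵢ))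
      ; witness    = w
      }

    -- If μ′ vanishes at every strict point, then εμᵢ = t · εκᵢ there.
    conformal-κ : (∀ i → Strict (σ i) → μ′ i ≈ 0#) → Conformal κ
    conformal-κ μ′-strict≈0 = record
      { dependence = dependence-scale dν (ε (σ k) * ν k)
      ; vanishes   = λ i σᵢ≡free → κ≤ν i (ν≤μ i (vanishes i σᵢ≡free))
      ; oriented   = λ i sᵢ → nonneg-cancelˡ 0<t (≤-respʳ-≈ (tεκ≈εμ i sᵢ) (oriented i sᵢ))
      ; witness    = k , strict-k , εκ≉0 0<εκₖ
      }
      where
      tεκ≈εμ : ∀ i → Strict (σ i) → ε (σ i) * μ i ≈ t * εκ i
      tεκ≈εμ i sᵢ = x∙y⁻¹≈ε⇒x≈y _ _
        (trans (sym (εμ′ i)) (trans (*-congˡ (μ′-strict≈0 i sᵢ)) (zeroʳ _)))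

    κ⊏μ : κ ⊏ μ
    κ⊏μ = let (x , μₓ≉0 , νₓ≈0) = proj₂ ν⊏μ
          in (λ i μᵢ≈0 → κ≤ν i (ν≤μ i μᵢ≈0)) , x , μₓ≉0 , κ≤ν x νₓ≈0

    shrink-strict : Σ (Vector Carrier n) λ μ″ → Conformal μ″ × μ″ ⊏ μ
    shrink-strict with any? (λ i → strict? (σ i) ×-dec ¬? (μ′ i ≟ 0#))
    ... | yes w   = μ′ , conformal-μ′ w , μ′⊏μ
    ... | no none = κ , conformal-κ (λ i sᵢ → decidable-stable (μ′ i ≟ 0#) λ μ′ᵢ≉0 → none (i , sᵢ , μ′ᵢ≉0)) , κ⊏μ

  shrink : ∀ {μ ν} → Conformal μ → Dependence ν → ν ⊏ μ → Σ (Fin n) (λ j → ¬ (ν j ≈ 0#)) →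
           Σ (Vector Carrier n) λ μ′ → Conformal μ′ × μ′ ⊏ μ
  shrink {ν = ν} cμ dν ν⊏μ (j , νⱼ≉0) with any? (λ i → strict? (σ i) ×-dec ¬? (ν i ≟ 0#))
  ... | yes (k , strict-k , νₖ≉0) = RatioTest.shrink-strict cμ dν ν⊏μ strict-k νₖ≉0
  ... | no none = shrink-hyperplane cμ dν ν⊏μ
                    (λ i sᵢ → decidable-stable (ν i ≟ 0#) λ νᵢ≉0 → none (i , sᵢ , νᵢ≉0)) νⱼ≉0

  -- By induction on the size of the support, a conformal
  -- dependence of minimal support is (the coefficient vector of) a circuit.
  no-conformal-dependence : ¬ ConformalCircuit → ∀ {μ} → ¬ Conformal μ
  no-conformal-dependence no-circuit {μ} = go μ (<-wellFounded ∣ support μ ∣)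
    where
    go : ∀ μ → Acc ℕ._<_ ∣ support μ ∣ → ¬ Conformal μ
    go μ (acc smaller) cμ = no-circuit (circuit-of cμ minimal)
      where
      minimal : ∀ T → T ⊂ support μ → ¬ AffinelyDependent F A T
      minimal T (T⊆S , x , x∈S , x∉T) (ν , dν , ν-outside , ν≉0) =
        let (μ′ , cμ′ , μ′⊏μ) = shrink cμ dν ν⊏μ ν≉0
        in go μ′ (smaller (⊏⇒∣support∣< μ′⊏μ)) cμ′
        where
        ν⊏μ : ν ⊏ μ
        ν⊏μ = (λ i μᵢ≈0 → ν-outside i λ i∈T → ∈-support⁻ (T⊆S i∈T) μᵢ≈0) ,
              x , ∈-support⁻ x∈S , ν-outside x x∉T

x∈p─q⇒x∉q : ∀ {n} (p q : Subset n) {x} → x ∈ p ─ q → x ∉ q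
x∈p─q⇒x∉q (inside ∷ p) (outside ∷ q) here ()
x∈p─q⇒x∉q (_ ∷ p) (_ ∷ q) (there x∈p─q) (there x∈q) = x∈p─q⇒x∉q p q x∈p─q x∈q

⊈⇒∃∉ : ∀ {n} (p q : Subset n) → ¬ (p ⊆ q) → ∃ λ i → i ∈ p × i ∉ q
⊈⇒∃∉ p q p⊈q with any? (λ i → (i ∈? p) ×-dec ¬? (i ∈? q))
... | yes found = found
... | no none   = ⊥-elim (p⊈q λ {i} i∈p → decidable-stable (i ∈? q) λ i∉q → none (i , i∈p , i∉q))

module TileComparison {n} {X Y X′ Y′ : Subset n} (X⊆Y : X ⊆ Y) (X′⊆Y′ : X′ ⊆ Y′) where

  Ahead : Subset n
  Ahead = (X ─ X′) ∪ (Y ─ Y′)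

  ahead⇒Y─X′ : ∀ {i} → i ∈ Ahead → i ∈ Y ─ X′
  ahead⇒Y─X′ i∈ with x∈p∪q⁻ (X ─ X′) (Y ─ Y′) i∈
  ... | inj₁ i∈X─X′ = x∈p∧x∉q⇒x∈p─q (X⊆Y (p─q⊆p X X′ i∈X─X′)) (x∈p─q⇒x∉q X X′ i∈X─X′)
  ... | inj₂ i∈Y─Y′ = x∈p∧x∉q⇒x∈p─q (p─q⊆p Y Y′ i∈Y─Y′) (x∈p─q⇒x∉q Y Y′ i∈Y─Y′ ∘ X′⊆Y′)

  ahead⇒¬Y′─X : ∀ {i} → i ∈ Ahead → i ∈ Y′ → i ∉ X → ⊥
  ahead⇒¬Y′─X i∈ i∈Y′ i∉X with x∈p∪q⁻ (X ─ X′) (Y ─ Y′) i∈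
  ... | inj₁ i∈X─X′ = i∉X (p─q⊆p X X′ i∈X─X′)
  ... | inj₂ i∈Y─Y′ = x∈p─q⇒x∉q Y Y′ i∈Y─Y′ i∈Y′

  Y─X′⇒ahead⊎Y′─X : ∀ {i} → i ∈ Y ─ X′ → i ∈ Ahead ⊎ (i ∈ Y′ × i ∉ X)
  Y─X′⇒ahead⊎Y′─X {i} i∈ with i ∈? X | i ∈? Y′
  ... | yes i∈X | _       = inj₁ (x∈p∪q⁺ (inj₁ (x∈p∧x∉q⇒x∈p─q i∈X (x∈p─q⇒x∉q Y X′ i∈))))
  ... | no i∉X  | yes i∈Y′ = inj₂ (i∈Y′ , i∉X)
  ... | no _    | no i∉Y′  = inj₁ (x∈p∪q⁺ (inj₂ (x∈p∧x∉q⇒x∈p─q (p─q⊆p Y X′ i∈) i∉Y′)))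

module TileRegions {n} {X₁ Y₁ X₂ Y₂ : Subset n} (X₁⊆Y₁ : X₁ ⊆ Y₁) (X₂⊆Y₂ : X₂ ⊆ Y₂) where
  private
    module First  = TileComparison X₁⊆Y₁ X₂⊆Y₂
    module Second = TileComparison X₂⊆Y₂ X₁⊆Y₁

  Pos Neg Zer : Subset n
  Pos = First.Ahead
  Neg = Second.Ahead
  Zer = (Y₁ ∩ Y₂) ─ (X₁ ∪ X₂)

  ∈Zer⁺ : ∀ {i} → i ∈ Y₁ ─ X₂ → i ∈ Y₂ → i ∉ X₁ → i ∈ Zer
  ∈Zer⁺ {i} i∈Y₁─X₂ i∈Y₂ i∉X₁ = x∈p∧x∉q⇒x∈p─q
    (x∈p∩q⁺ (p─q⊆p Y₁ X₂ i∈Y₁─X₂ , i∈Y₂))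
    λ i∈X → [ i∉X₁ , x∈p─q⇒x∉q Y₁ X₂ i∈Y₁─X₂ ]′ (x∈p∪q⁻ X₁ X₂ i∈X)

  Zer⊆Y₁─X₂ : ∀ {i} → i ∈ Zer → i ∈ Y₁ ─ X₂
  Zer⊆Y₁─X₂ z = x∈p∧x∉q⇒x∈p─q (proj₁ (x∈p∩q⁻ Y₁ Y₂ (p─q⊆p _ _ z)))
                              (x∈p─q⇒x∉q _ _ z ∘ x∈p∪q⁺ ∘ inj₂)

  Zer⊆Y₂─X₁ : ∀ {i} → i ∈ Zer → i ∈ Y₂ ─ X₁
  Zer⊆Y₂─X₁ z = x∈p∧x∉q⇒x∈p─q (proj₂ (x∈p∩q⁻ Y₁ Y₂ (p─q⊆p _ _ z)))
                              (x∈p─q⇒x∉q _ _ z ∘ x∈p∪q⁺ ∘ inj₁)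

  Y₁─X₂⊆Pos∪Zer : ∀ {i} → i ∈ Y₁ ─ X₂ → i ∈ Pos ⊎ i ∈ Zer
  Y₁─X₂⊆Pos∪Zer i∈ = map₂ (λ (i∈Y₂ , i∉X₁) → ∈Zer⁺ i∈ i∈Y₂ i∉X₁) (First.Y─X′⇒ahead⊎Y′─X i∈)

  Y₂─X₁⊆Neg∪Zer : ∀ {i} → i ∈ Y₂ ─ X₁ → i ∈ Neg ⊎ i ∈ Zer
  Y₂─X₁⊆Neg∪Zer i∈ with Second.Y─X′⇒ahead⊎Y′─X i∈
  ... | inj₁ i∈Neg          = inj₁ i∈Neg
  ... | inj₂ (i∈Y₁ , i∉X₂) = inj₂ (∈Zer⁺ (x∈p∧x∉q⇒x∈p─q i∈Y₁ i∉X₂) (p─q⊆p Y₂ X₁ i∈) (x∈p─q⇒x∉q Y₂ X₁ i∈))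

  Pos∩Neg : ∀ {i} → i ∈ Pos → i ∈ Neg → ⊥
  Pos∩Neg i∈Pos i∈Neg = let i∈Y₂─X₁ = Second.ahead⇒Y─X′ i∈Neg in
    First.ahead⇒¬Y′─X i∈Pos (p─q⊆p Y₂ X₁ i∈Y₂─X₁) (x∈p─q⇒x∉q Y₂ X₁ i∈Y₂─X₁)

  Pos∩Zer : ∀ {i} → i ∈ Pos → i ∈ Zer → ⊥
  Pos∩Zer i∈Pos z = let i∈Y₂─X₁ = Zer⊆Y₂─X₁ z in
    First.ahead⇒¬Y′─X i∈Pos (p─q⊆p Y₂ X₁ i∈Y₂─X₁) (x∈p─q⇒x∉q Y₂ X₁ i∈Y₂─X₁)

  Neg∩Zer : ∀ {i} → i ∈ Neg → i ∈ Zer → ⊥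
  Neg∩Zer i∈Neg z = let i∈Y₁─X₂ = Zer⊆Y₁─X₂ z in
    Second.ahead⇒¬Y′─X i∈Neg (p─q⊆p Y₁ X₂ i∈Y₁─X₂) (x∈p─q⇒x∉q Y₁ X₂ i∈Y₁─X₂)

  data Region (i : Fin n) : Sign → Set where
    pos  : i ∈ Pos → Region i pos
    neg  : i ∈ Neg → Region i neg
    hyp  : i ∈ Zer → Region i hyp
    free : i ∉ Pos → i ∉ Neg → i ∉ Zer → Region i free

  classify : ∀ i → Σ Sign (Region i)
  classify i with i ∈? Pos | i ∈? Neg | i ∈? Zer
  ... | yes i∈Pos | _         | _         = pos , pos i∈Pos
  ... | no _      | yes i∈Neg | _         = neg , neg i∈Neg
  ... | no _      | no _      | yes i∈Zer = hyp , hyp i∈Zer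
  ... | no i∉Pos  | no i∉Neg  | no i∉Zer  = free , free i∉Pos i∉Neg i∉Zer

  label : Fin n → Sign
  label i = proj₁ (classify i)

  label-pos : ∀ {i} → i ∈ Pos → label i ≡ pos
  label-pos {i} i∈Pos with classify i
  ... | pos  , _            = ≡.refl
  ... | neg  , neg i∈Neg    = ⊥-elim (Pos∩Neg i∈Pos i∈Neg)
  ... | hyp  , hyp i∈Zer    = ⊥-elim (Pos∩Zer i∈Pos i∈Zer)
  ... | free , free i∉Pos _ _ = ⊥-elim (i∉Pos i∈Pos)

  label-neg : ∀ {i} → i ∈ Neg → label i ≡ neg
  label-neg {i} i∈Neg with classify i
  ... | pos  , pos i∈Pos    = ⊥-elim (Pos∩Neg i∈Pos i∈Neg)
  ... | neg  , _            = ≡.refl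
  ... | hyp  , hyp i∈Zer    = ⊥-elim (Neg∩Zer i∈Neg i∈Zer)
  ... | free , free _ i∉Neg _ = ⊥-elim (i∉Neg i∈Neg)

  label-hyp : ∀ {i} → i ∈ Zer → label i ≡ hyp
  label-hyp {i} i∈Zer with classify i
  ... | pos  , pos i∈Pos    = ⊥-elim (Pos∩Zer i∈Pos i∈Zer)
  ... | neg  , neg i∈Neg    = ⊥-elim (Neg∩Zer i∈Neg i∈Zer)
  ... | hyp  , _            = ≡.refl
  ... | free , free _ _ i∉Zer = ⊥-elim (i∉Zer i∈Zer)

  admits⁺⇒Y₁─X₂ : ∀ {i} → Admits⁺ (label i) → i ∈ Y₁ ─ X₂
  admits⁺⇒Y₁─X₂ {i} a with classify i
  admits⁺⇒Y₁─X₂ pos | pos , pos i∈Pos = First.ahead⇒Y─X′ i∈Pos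
  admits⁺⇒Y₁─X₂ hyp | hyp , hyp i∈Zer = Zer⊆Y₁─X₂ i∈Zer

  admits⁻⇒Y₂─X₁ : ∀ {i} → Admits⁻ (label i) → i ∈ Y₂ ─ X₁
  admits⁻⇒Y₂─X₁ {i} a with classify i
  admits⁻⇒Y₂─X₁ neg | neg , neg i∈Neg = Second.ahead⇒Y─X′ i∈Neg
  admits⁻⇒Y₂─X₁ hyp | hyp , hyp i∈Zer = Zer⊆Y₂─X₁ i∈Zer

  strict⇒∉Zer : ∀ {i} → Strict (label i) → i ∉ Zer
  strict⇒∉Zer s i∈Zer with ≡.subst Strict (label-hyp i∈Zer) s
  ... | ()

module TileSeparation {c ℓ₁ ℓ₂ : Level} (F : OrderedField c ℓ₁ ℓ₂) {d n : ℕ} (A : Config F d n)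
                      {X₁ Y₁ X₂ Y₂ : Subset n} (X₁⊆Y₁ : X₁ ⊆ Y₁) (X₂⊆Y₂ : X₂ ⊆ Y₂) where
  open OrderedField F hiding (_<_; zero)
  open OrderedFieldProperties F
  open Farkas F
  open AffineDependences F A
  open TileRegions X₁⊆Y₁ X₂⊆Y₂
  open ConformalCircuits F A label
  open import Relation.Binary.Reasoning.Setoid setoid

  SeparatingFunctional : Set (c ⊔ ℓ₁ ⊔ ℓ₂)
  SeparatingFunctional = Σ (AffineFunctional F d) λ f →
    (∀ i → i ∈ Pos → 0# < evalAff F f (A i)) ×
    (∀ i → i ∈ Neg → evalAff F f (A i) < 0#) ×
    (∀ i → i ∈ Zer → evalAff F f (A i) ≈ 0#)

  -- (⇐) Given such an f and a circuit λ as in the definition of separation,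
  -- every term λᵢ f(aᵢ) is ≥ 0 and some is > 0, yet Σ λᵢ f(aᵢ) = 0.
  functional⇒separated : SeparatingFunctional → Separated F A X₁ Y₁ X₂ Y₂
  functional⇒separated (f , f-pos , f-neg , f-zer)
    (C⁺ , C⁻ , (_ , _ , λ′ , dλ , λ-outside , λ-pos , λ-neg) , C⁺⊆ , C⁻⊆ , C⊈Zer) =
    let (i , i∈C , i∉Zer) = ⊈⇒∃∉ (C⁺ ∪ C⁻) Zer C⊈Zer
    in <⇒≉ (∑-pos (proj₁ ∘ term) i (proj₂ (term i) i∈C i∉Zer)) (sym (dependence-annihilates dλ f))
    where
    e : Fin n → Carrier
    e i = evalAff F f (A i)

    zero-term : ∀ {i} → e i ≈ 0# → 0# ≤ λ′ i * e i
    zero-term eᵢ≈0 = ≤-reflexive (sym (trans (*-congˡ eᵢ≈0) (zeroʳ _)))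

    term : ∀ i → 0# ≤ λ′ i * e i × (i ∈ C⁺ ∪ C⁻ → i ∉ Zer → 0# < λ′ i * e i)
    term i with i ∈? C⁺ | i ∈? C⁻
    ... | yes i∈C⁺ | _ with Y₁─X₂⊆Pos∪Zer (C⁺⊆ i∈C⁺)
    ...   | inj₁ i∈Pos = let p = *-pos (λ-pos i i∈C⁺) (f-pos i i∈Pos) in <⇒≤ p , λ _ _ → p
    ...   | inj₂ i∈Zer = zero-term (f-zer i i∈Zer) , λ _ i∉Zer → ⊥-elim (i∉Zer i∈Zer)
    term i | no _ | yes i∈C⁻ with Y₂─X₁⊆Neg∪Zer (C⁻⊆ i∈C⁻)
    ...   | inj₁ i∈Neg = let p = <0*<0 (λ-neg i i∈C⁻) (f-neg i i∈Neg) in <⇒≤ p , λ _ _ → p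
    ...   | inj₂ i∈Zer = zero-term (f-zer i i∈Zer) , λ _ i∉Zer → ⊥-elim (i∉Zer i∈Zer)
    term i | no i∉C⁺ | no i∉C⁻ =
      ≤-reflexive (sym (trans (*-congʳ λᵢ≈0) (zeroˡ _))) , λ i∈C _ → ⊥-elim (i∉C i∈C)
      where
      i∉C : i ∉ C⁺ ∪ C⁻
      i∉C i∈C = [ i∉C⁺ , i∉C⁻ ]′ (x∈p∪q⁻ C⁺ C⁻ i∈C)
      λᵢ≈0 : λ′ i ≈ 0#
      λᵢ≈0 = λ-outside i i∉C

  -- (⇒) The unknowns of the linear system: a slack s, the constant b and the
  -- linear part w of the functional, stored as (s , b , w).
  Unknowns : Set c
  Unknowns = Vector Carrier (ℕ.suc (ℕ.suc d))

  slack : Unknowns → Carrier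
  slack x = x zero

  functional : Unknowns → AffineFunctional F d
  functional x = (λ j → x (suc (suc j))) , x (suc zero)

  row : Fin n → Carrier → Carrier → Unknowns
  row i k a zero          = k
  row i k a (suc zero)    = a
  row i k a (suc (suc j)) = a * A i j

  row-value : ∀ i k a x → row i k a · x ≈ k * slack x + a * evalAff F (functional x) (A i)
  row-value i k a x = +-congˡ (begin
    a * b + ∑ (λ j → (a * A i j) * w j)   ≈⟨ +-congˡ (∑-cong (λ j → solve 3 (λ a y z → (a :* y) :* z := a :* (z :* y))
                                                                         refl a (A i j) (w j))) ⟩
    a * b + ∑ (λ j → a * (w j * A i j))   ≈⟨ +-congˡ (∑-*ˡ a (λ j → w j * A i j)) ⟩
    a * b + a * ∑ (λ j → w j * A i j)     ≈⟨ solve 3 (λ a b S → a :* b :+ a :* S := a :* (S :+ b)) refl a b _ ⟩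
    a * (∑ (λ j → w j * A i j) + b)       ∎)
    where
    b : Carrier
    b = x (suc zero)
    w : Vector Carrier d
    w = λ j → x (suc (suc j))

  -- Coefficients of the two rows of a point with sign s: the first row
  -- says  f(aᵢ) ≥ s, −f(aᵢ) ≥ s  or  f(aᵢ) ≥ 0, the second  −f(aᵢ) ≥ 0  on Zer.
  slack-coeff value-coeff reverse-coeff : Sign → Carrier
  slack-coeff pos  = - 1#
  slack-coeff neg  = - 1#
  slack-coeff hyp  = 0#
  slack-coeff free = 0#
  value-coeff pos  = 1#
  value-coeff neg  = - 1#
  value-coeff hyp  = 1#
  value-coeff free = 0#
  reverse-coeff hyp = - 1#
  reverse-coeff _   = 0#

  first-rows second-rows : Fin n → Unknowns
  first-rows i  = row i (slack-coeff (label i)) (value-coeff (label i))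
  second-rows i = row i 0# (reverse-coeff (label i))

  rows : Fin (n ℕ.+ n) → Unknowns
  rows = first-rows ++ second-rows

  -- The objective: we look for x with rows · x ≥ 0 and s > 0.
  target : Unknowns
  target zero    = - 1#
  target (suc _) = 0#

  target-value : ∀ x → target · x ≈ - slack x
  target-value x = begin
    - 1# * slack x + ∑ (λ j → 0# * x (suc j))  ≈⟨ +-cong (-1*x≈-x (slack x)) (∑-cong (λ j → zeroˡ (x (suc j)))) ⟩
    - slack x + ∑ {ℕ.suc d} (λ _ → 0#)         ≈⟨ +-congˡ (∑-zero (ℕ.suc d)) ⟩
    - slack x + 0#                             ≈⟨ +-identityʳ _ ⟩
    - slack x                                  ∎

  positive-row : ∀ {s e} → 0# < s → 0# ≤ slack-coeff pos * s + value-coeff pos * e → 0# < e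
  positive-row {s} {e} 0<s 0≤row = <-≤-trans 0<s (0≤y-x⇒x≤y (≤-respʳ-≈ eq 0≤row))
    where
    eq : - 1# * s + 1# * e ≈ e - s
    eq = trans (+-cong (-1*x≈-x s) (*-identityˡ e)) (+-comm _ _)

  negative-row : ∀ {s e} → 0# < s → 0# ≤ slack-coeff neg * s + value-coeff neg * e → e < 0#
  negative-row {s} {e} 0<s 0≤row = 0<-x⇒x<0 (<-≤-trans 0<s (0≤y-x⇒x≤y (≤-respʳ-≈ eq 0≤row)))
    where
    eq : - 1# * s + - 1# * e ≈ - e - s
    eq = trans (+-cong (-1*x≈-x s) (-1*x≈-x e)) (+-comm _ _)

  hyperplane-rows : ∀ {s e} → 0# ≤ slack-coeff hyp * s + value-coeff hyp * e →
                    0# ≤ 0# * s + reverse-coeff hyp * e → e ≈ 0#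
  hyperplane-rows {s} {e} 0≤row₁ 0≤row₂ = ≤-antisym
    (0≤-x⇒x≤0 (≤-respʳ-≈ (trans (+-cong (zeroˡ s) (-1*x≈-x e)) (+-identityˡ _)) 0≤row₂))
    (≤-respʳ-≈ (trans (+-cong (zeroˡ s) (*-identityˡ e)) (+-identityˡ _)) 0≤row₁)

  certificate⇒functional : Separating rows target → SeparatingFunctional
  certificate⇒functional (x , rows-nonneg , target·x<0) =
    functional x ,
    (λ i i∈Pos → positive-row 0<s (≡.subst (First i) (label-pos i∈Pos) (first i))) ,
    (λ i i∈Neg → negative-row 0<s (≡.subst (First i) (label-neg i∈Neg) (first i))) ,
    (λ i i∈Zer → hyperplane-rows (≡.subst (First i) (label-hyp i∈Zer) (first i))
                                 (≡.subst (Second i) (label-hyp i∈Zer) (second i)))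
    where
    e : Fin n → Carrier
    e i = evalAff F (functional x) (A i)
    0<s : 0# < slack x
    0<s = -x<0⇒0<x (<-respˡ-≈ (target-value x) target·x<0)
    First Second : Fin n → Sign → Set (ℓ₁ ⊔ ℓ₂)
    First i s  = 0# ≤ slack-coeff s * slack x + value-coeff s * e i
    Second i s = 0# ≤ 0# * slack x + reverse-coeff s * e i
    first : ∀ i → First i (label i)
    first i = ≤-respʳ-≈ (row-value i _ _ x)
      (≡.subst (λ r → 0# ≤ r · x) (lookup-++ˡ first-rows second-rows i) (rows-nonneg (i ↑ˡ n)))
    second : ∀ i → Second i (label i)
    second i = ≤-respʳ-≈ (row-value i _ _ x)
      (≡.subst (λ r → 0# ≤ r · x) (lookup-++ʳ first-rows second-rows i) (rows-nonneg (n ↑ʳ i)))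

  -- A nonnegative combination of the rows equal to the target yields a
  -- dependence conformal to the labelling: its coordinates are the weights
  -- of the rows of each point, signed by the value coefficients.
  module Combination (λ′ : Vector Carrier (n ℕ.+ n)) (λ′-nonneg : ∀ i → 0# ≤ λ′ i)
                     (target≈ : ∀ j → target j ≈ ∑ (λ i → λ′ i * rows i j)) where
    l₁ l₂ : Vector Carrier n
    l₁ i = λ′ (i ↑ˡ n)
    l₂ i = λ′ (n ↑ʳ i)

    coefficient : Sign → Fin n → Carrier
    coefficient s i = l₁ i * value-coeff s + l₂ i * reverse-coeff s

    μ : Vector Carrier n
    μ i = coefficient (label i) i

    target-split : ∀ j → target j ≈ ∑ (λ i → l₁ i * first-rows i j) + ∑ (λ i → l₂ i * second-rows i j)
    target-split j = trans (target≈ j) (trans (∑-split {n} {n} (λ i → λ′ i * rows i j)) (+-cong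
      (∑-cong (λ i → *-congˡ (reflexive (≡.cong (λ r → r j) (lookup-++ˡ first-rows second-rows i)))))
      (∑-cong (λ i → *-congˡ (reflexive (≡.cong (λ r → r j) (lookup-++ʳ first-rows second-rows i)))))))

    μ-dependence : Dependence μ
    μ-dependence =
      (λ j → trans (∑-cong (λ i → solve 5 (λ l v m r a → (l :* v :+ m :* r) :* a := l :* (v :* a) :+ m :* (r :* a))
                                        refl (l₁ i) (value-coeff (label i)) (l₂ i) (reverse-coeff (label i)) (A i j)))
             (trans (∑-+ (λ i → l₁ i * first-rows i (suc (suc j))) (λ i → l₂ i * second-rows i (suc (suc j))))
                    (sym (target-split (suc (suc j)))))) ,
      trans (∑-+ (λ i → l₁ i * first-rows i (suc zero)) (λ i → l₂ i * second-rows i (suc zero)))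
            (sym (target-split (suc zero)))

    coefficient-free : ∀ i → coefficient free i ≈ 0#
    coefficient-free i = trans (+-cong (zeroʳ (l₁ i)) (zeroʳ (l₂ i))) (+-identityʳ 0#)

    coefficient-strict : ∀ {s} → Strict s → ∀ i → ε s * coefficient s i ≈ l₁ i
    coefficient-strict pos i = begin
      1# * (l₁ i * 1# + l₂ i * 0#)  ≈⟨ *-identityˡ _ ⟩
      l₁ i * 1# + l₂ i * 0#         ≈⟨ +-cong (*-identityʳ (l₁ i)) (zeroʳ (l₂ i)) ⟩
      l₁ i + 0#                     ≈⟨ +-identityʳ (l₁ i) ⟩
      l₁ i                          ∎
    coefficient-strict neg i = begin
      - 1# * (l₁ i * - 1# + l₂ i * 0#)  ≈⟨ -1*x≈-x _ ⟩
      - (l₁ i * - 1# + l₂ i * 0#)       ≈⟨ -‿cong (trans (+-cong (*-comm (l₁ i) (- 1#)) (zeroʳ (l₂ i))) (+-identityʳ _)) ⟩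
      - (- 1# * l₁ i)                   ≈⟨ -‿cong (-1*x≈-x (l₁ i)) ⟩
      - (- l₁ i)                        ≈⟨ -‿involutive (l₁ i) ⟩
      l₁ i                              ∎

    -- The slack coordinate of the target, −1, is a combination of first
    -- weights at strict points, so one of them is nonzero.
    strict-weight : Σ (Fin n) λ i → Strict (label i) × ¬ (l₁ i ≈ 0#)
    strict-weight = let (i , term≉0) = ∑-nonzero (λ i → l₁ i * slack-coeff (label i)) ∑≉0
                    in i , strict-of (label i) term≉0
      where
      ∑≉0 : ¬ (∑ (λ i → l₁ i * slack-coeff (label i)) ≈ 0#)
      ∑≉0 ∑≈0 = 1≉0 (begin
        1#                    ≈⟨ -‿involutive 1# ⟨
        - (- 1#)              ≈⟨ -‿cong (target-split zero) ⟩
        - (∑ (λ i → l₁ i * slack-coeff (label i)) + ∑ (λ i → l₂ i * 0#))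
                              ≈⟨ -‿cong (+-cong ∑≈0 (trans (∑-cong (λ i → zeroʳ (l₂ i))) (∑-zero n))) ⟩
        - (0# + 0#)           ≈⟨ -‿cong (+-identityʳ 0#) ⟩
        - 0#                  ≈⟨ -0#≈0# ⟩
        0#                    ∎)
      strict-of : ∀ s {i} → ¬ (l₁ i * slack-coeff s ≈ 0#) → Strict s × ¬ (l₁ i ≈ 0#)
      strict-of pos term≉0 = pos , λ l≈0 → term≉0 (trans (*-congʳ l≈0) (zeroˡ _))
      strict-of neg term≉0 = neg , λ l≈0 → term≉0 (trans (*-congʳ l≈0) (zeroˡ _))
      strict-of hyp  term≉0 = ⊥-elim (term≉0 (zeroʳ _))
      strict-of free term≉0 = ⊥-elim (term≉0 (zeroʳ _))

    conformal : Conformal μ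
    conformal = record
      { dependence = μ-dependence
      ; vanishes   = λ i σᵢ≡free → trans (reflexive (≡.cong (λ s → coefficient s i) σᵢ≡free)) (coefficient-free i)
      ; oriented   = λ i s → ≤-respʳ-≈ (sym (coefficient-strict s i)) (λ′-nonneg (i ↑ˡ n))
      ; witness    = let (i , s , l₁≉0) = strict-weight
                     in i , s , λ μᵢ≈0 → l₁≉0 (trans (sym (coefficient-strict s i))
                                                     (trans (*-congˡ μᵢ≈0) (zeroʳ _)))
      }

  separated⇒no-circuit : Separated F A X₁ Y₁ X₂ Y₂ → ¬ ConformalCircuit
  separated⇒no-circuit separated (C⁺ , C⁻ , circuit , admits⁺ , admits⁻ , i , i∈C , strict-i) =
    separated (C⁺ , C⁻ , circuit , admits⁺⇒Y₁─X₂ ∘ admits⁺ , admits⁻⇒Y₂─X₁ ∘ admits⁻ ,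
               λ C⊆Zer → strict⇒∉Zer strict-i (C⊆Zer i∈C))

  -- (⇒) By Farkas' lemma the system has a solution, or a nonnegative
  -- combination gives a conformal dependence, hence a conformal circuit,
  -- which separation excludes.
  separated⇒functional : Separated F A X₁ Y₁ X₂ Y₂ → SeparatingFunctional
  separated⇒functional separated with farkas rows target
  ... | inj₁ certificate = certificate⇒functional certificate
  ... | inj₂ (λ′ , λ′-nonneg , target≈) =
    ⊥-elim (no-conformal-dependence (separated⇒no-circuit separated) (Combination.conformal λ′ λ′-nonneg target≈))

proposition4p3 : ∀ {c ℓ₁ ℓ₂ : Level} (F : OrderedField c ℓ₁ ℓ₂) (d n : ℕ)
    (A : Config F d n) (X₁ Y₁ X₂ Y₂ : Subset n) →
    IsTile F X₁ Y₁ → IsTile F X₂ Y₂ →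
    Separated F A X₁ Y₁ X₂ Y₂ ⇔
      Σ (AffineFunctional F d) (λ f →
        (∀ (i : Fin n) → i ∈ ((X₁ ─ X₂) ∪ (Y₁ ─ Y₂)) →
            OrderedField._<_ F (OrderedField.0# F) (evalAff F f (A i)))
        × (∀ (i : Fin n) → i ∈ ((X₂ ─ X₁) ∪ (Y₂ ─ Y₁)) →
            OrderedField._<_ F (evalAff F f (A i)) (OrderedField.0# F))
        × (∀ (i : Fin n) → i ∈ ((Y₁ ∩ Y₂) ─ (X₁ ∪ X₂)) →
            OrderedField._≈_ F (evalAff F f (A i)) (OrderedField.0# F)))
proposition4p3 F d n A X₁ Y₁ X₂ Y₂ X₁⊆Y₁ X₂⊆Y₂ = mk⇔ separated⇒functional functional⇒separated
  where open TileSeparation F A X₁⊆Y₁ X₂⊆Y₂
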